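{- For every non-empty index $\boldsymbol{k}$ and every non-negative integer $m$, \begin{align*} G_m((1);t)&=(1+m),\\ G_m(\boldsymbol{k}_{\uparrow};t)&=G_m(\boldsymbol{k};t)_{\uparrow}+tG_{m-1}(\boldsymbol{k}_{\uparrow};t)_{\uparrow},\\ G_m(\boldsymbol{k}_{\rightarrow};t)&=G_m(\boldsymbol{k};t)_{\uparrow}+G_m(\boldsymbol{k};t)_{\rightarrow}-(1-t)G_m(\boldsymbol{k}_{\uparrow};t)+(1-t)G_{m-1}(\boldsymbol{k}_{\rightarrow\uparrow};t). \end{align*}
   Context: Let $t$ be an indeterminate and $\mathcal{I}^t$ the set of formal $\mathbb{Q}[t]$-linear combinations of indices (tuples of positive integers). $I^t\colon\mathcal{I}^t\to\mathcal{I}^t$ is the $\mathbb{Q}[t]$-linear map with $I^t(\varnothing)=\varnothing$ and $I^t(k_1,\dots,k_r)=\sum t^{(\text{number of }+)}(k_1\square\cdots\square k_r)$, summed over all choices of each $\square$ as a comma or a plus (a plus adds the neighbouring entries). For a non-empty index $\boldsymbol{k}=(k_1,\dots,k_r)$, $\boldsymbol{k}_\uparrow=(k_1,\dots,k_{r-1},k_r+1)$, $\boldsymbol{k}_\rightarrow=(k_1,\dots,k_r,1)$, $\boldsymbol{k}_{\rightarrow\uparrow}=(k_1,\dots,k_r,2)$, extended $\mathbb{Q}[t]$-linearly to combinations of non-empty indices. Binomial coefficients: for integer $n$ and integer $j\ge0$, $\binom{n}{j}=n(n-1)\cdots(n-j+1)/j!$. For integers $k$, $i\ge0$, $e\ge0$,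 $f_i(k,e)=\sum_{j=0}^{e}\binom{e-j}{i}\binom{k+e-i-2}{j}t^j(1-t)^{e-i-j}$. For a non-empty index $\boldsymbol{k}=(k_1,\dots,k_r)$ and $m\ge0$, with $k'_j\coloneqq k_j+\delta_{j,1}$, $g_m(\boldsymbol{k};t)=\sum_{l=1}^{r}(-t(1-t))^{r-l}\sum_{(e_1,\dots,e_l)\in\mathbb{Z}_{\ge0}^l,\ \sum e_i=m}\ \sum_{1=i_1<\cdots<i_{l+1}=r+1}\prod_{l'=1}^{l}f_{i_{l'+1}-i_{l'}-1}(k'_{i_{l'}}+\cdots+k'_{i_{l'+1}-1},e_{l'})\cdot(k_{i_1}+\cdots+k_{i_2-1}+e_1,\dots,k_{i_l}+\cdots+k_{i_{l+1}-1}+e_l)$, $g_{ -1}(\boldsymbol{k};t)=0$, and $G_m(\boldsymbol{k};t)\coloneqq I^t(g_m(\boldsymbol{k};t))$ for $m\ge-1$. -}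

module Defs where

open import Data.Nat as ℕ using (ℕ; zero; suc; _∸_)
open import Data.Integer as ℤ using (ℤ; +_)
open import Data.Rational as ℚ using (ℚ; 0ℚ; 1ℚ)
open import Data.List using (List; []; _∷_; _++_; map; concatMap; foldr; length; upTo)
open import Data.Nat.ListAction using (sum)
open import Data.List.Properties using (≡-dec)
open import Data.Product using (_×_; _,_)
open import Relation.Nullary using (yes; no)
open import Relation.Binary.PropositionalEquality using (_≡_)

-- Indices: tuples of (positive) integers, as lists of naturals.
Index : Set
Index = List ℕ

-- Polynomials in t over ℚ, as formal sums of monomials q·t^j.
Poly : Set
Poly = List (ℚ × ℕ)

polyMul : Poly → Poly → Poly
polyMul p q = concatMap (λ { (a , i) → map (λ { (b , j) → (a ℚ.* b , i ℕ.+ j) }) q }) p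

polyPow : Poly → ℕ → Poly
polyPow p zero    = (1ℚ , 0) ∷ []
polyPow p (suc n) = polyMul p (polyPow p n)

oneMinusT : Poly
oneMinusT = (1ℚ , 0) ∷ (ℚ.- 1ℚ , 1) ∷ []

minusTOneMinusT : Poly
minusTOneMinusT = polyMul ((ℚ.- 1ℚ , 1) ∷ []) oneMinusT

-- Elements of 𝓘^t: formal ℚ[t]-linear combinations of indices,
-- as finite formal sums of terms q·t^j·κ.
LC : Set
LC = List (ℚ × ℕ × Index)

coeff : LC → Index → ℕ → ℚ
coeff [] κ j = 0ℚ
coeff ((q , i , λ′) ∷ A) κ j with ≡-dec ℕ._≟_ λ′ κ | i ℕ.≟ j
... | yes _ | yes _ = q ℚ.+ coeff A κ j
... | _     | _     = coeff A κ j

infix 4 _≈_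
_≈_ : LC → LC → Set
A ≈ B = ∀ (κ : Index) (j : ℕ) → coeff A κ j ≡ coeff B κ j

⟦_⟧ : Index → LC
⟦ κ ⟧ = (1ℚ , 0 , κ) ∷ []

infixl 6 _⊕_ _⊖_
_⊕_ : LC → LC → LC
A ⊕ B = A ++ B

neg : LC → LC
neg = map (λ { (q , i , κ) → (ℚ.- q , i , κ) })

_⊖_ : LC → LC → LC
A ⊖ B = A ++ neg B

infixr 7 _·_
_·_ : Poly → LC → LC
p · A = concatMap (λ { (a , i) → map (λ { (q , j , κ) → (a ℚ.* q , i ℕ.+ j , κ) }) A }) p

t : Poly
t = (1ℚ , 1) ∷ []

mapIdx : (Index → Index) → LC → LC
mapIdx f = map (λ { (q , j , κ) → (q , j , f κ) })

-- arrows (on non-empty indices; the empty case is never used)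
upI : Index → Index
upI []           = []
upI (x ∷ [])     = suc x ∷ []
upI (x ∷ y ∷ xs) = x ∷ upI (y ∷ xs)

_↑ : LC → LC
A ↑ = mapIdx upI A

_→′ : LC → LC
A →′ = mapIdx (λ κ → κ ++ (1 ∷ [])) A

_→↑ : LC → LC
A →↑ = mapIdx (λ κ → κ ++ (2 ∷ [])) A

upIdx : Index → Index
upIdx = upI

rightIdx : Index → Index
rightIdx κ = κ ++ (1 ∷ [])

rightUpIdx : Index → Index
rightUpIdx κ = κ ++ (2 ∷ [])

-- I^t : all ways to replace each separator by "," or "+",
-- recording the number of "+".
combos : Index → List (ℕ × Index)
combos []       = (0 , []) ∷ []
combos (x ∷ xs) = concatMap step (combos xs)
  where
  step : ℕ × Index → List (ℕ × Index)
  step (p , [])     = (p , x ∷ []) ∷ []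
  step (p , z ∷ zs) = (p , x ∷ z ∷ zs) ∷ (suc p , (x ℕ.+ z) ∷ zs) ∷ []

It : LC → LC
It = concatMap (λ { (q , j , κ) → map (λ { (p , κ′) → (q , j ℕ.+ p , κ′) }) (combos κ) })

binom : ℤ → ℕ → ℚ
binom n zero    = 1ℚ
binom n (suc j) = binom n j ℚ.* ((n ℤ.- + j) ℚ./ suc j)

-- f_i(k,e) = Σ_{j=0}^{e} C(e-j,i) C(k+e-i-2,j) t^j (1-t)^{e-i-j}
-- (when e-i-j < 0 the coefficient C(e-j,i) vanishes, since 0 ≤ e-j < i,
--  so truncated subtraction in the exponent is harmless)
f : ℕ → ℤ → ℕ → Poly
f i k e = concatMap term (upTo (suc e))
  where
  term : ℕ → Poly
  term j = polyMul ((binom (+ (e ∸ j)) i ℚ.* binom ((k ℤ.+ + e) ℤ.- + (i ℕ.+ 2)) j , j) ∷ [])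
                   (polyPow oneMinusT (e ∸ i ∸ j))

-- all decompositions of a list into consecutive non-empty blocks
-- (i.e. all 1 = i_1 < … < i_{l+1} = r+1)
blocks : Index → List (List Index)
blocks []       = [] ∷ []
blocks (x ∷ xs) = concatMap step (blocks xs)
  where
  step : List Index → List (List Index)
  step []      = ((x ∷ []) ∷ []) ∷ []
  step (b ∷ D) = ((x ∷ []) ∷ b ∷ D) ∷ ((x ∷ b) ∷ D) ∷ []

comps : ℕ → ℕ → List (List ℕ)
comps zero    zero    = [] ∷ []
comps (suc m) zero    = []
comps m       (suc l) = concatMap (λ e → map (e ∷_) (comps (m ∸ e) l)) (upTo (suc m))

-- Π_{l'} f_{|B_{l'}|-1}(Σ k'_{B_{l'}}, e_{l'}) · (Σ k_{B_1}+e_1, …, Σ k_{B_l}+e_l)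
-- `first` records whether the block is the first one (k'_1 = k_1 + 1)
blockTerm : ℕ → List Index → List ℕ → Poly × Index
blockTerm first (b ∷ D) (e ∷ es) with blockTerm 0 D es
... | (p , κ) = polyMul (f (length b ∸ 1) (+ (sum b ℕ.+ first)) e) p , (sum b ℕ.+ e) ∷ κ
blockTerm first _ _ = (1ℚ , 0) ∷ [] , []

g : ℕ → Index → LC
g m k = concatMap perBlocks (blocks k)
  where
  r = length k
  perBlocks : List Index → LC
  perBlocks D = concatMap perE (comps m (length D))
    where
    perE : List ℕ → LC
    perE es with blockTerm 1 D es
    ... | (p , κ) = polyMul (polyPow minusTOneMinusT (r ∸ length D)) p · ⟦ κ ⟧

G : ℕ → Index → LC
G m k = It (g m k)

-- G_{m-1}(k;t) for m ≥ 0 (so that G_{-1} = I^t(g_{-1}) = I^t(0) = 0)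
Gprev : ℕ → Index → LC
Gprev zero    k = []
Gprev (suc m) k = G m k

{-# OPTIONS --safe #-}

-- An element of 𝓘^t is determined by its pairings ⟪ A ⟫ w with weights w : Index → ℕ → ℚ
-- (w κ j is the value on t^j κ), and ↑, →, multiplication by polynomials and I^t all have
-- adjoints on weights. The identities thus become identities between the numbers
-- ⟪ g_m(k) ⟫ w, which are computed block by block along the decompositions of k into
-- consecutive blocks. The decompositions of k↑ and k→ come from those of k by modifying or
-- adding a last block, and on that last block everything reduces to the Pascal-type
-- recurrences  f_i(k+1,e+1) = f_i(k,e+1) + t f_i(k+1,e)  and
-- f_{i+1}(k+1,e+1) = f_i(k+1,e) + (1-t) f_{i+1}(k+2,e),  consequences of Pascal's rule for
-- the binomial coefficients in f; moreover f_0(2,e) = 1, which gives G_m((1)) = (1+m).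
-- Finally, I^t(κ→) = I^t(κ)→ + t I^t(κ)↑ turns the recursion of g_m(k→) into that of G_m(k→).
module Submission where

open import Defs
open import Data.Empty using (⊥; ⊥-elim)
open import Data.Integer as ℤ using (ℤ)
import Data.Integer.Properties as ℤP
import Data.Integer.Solver as ℤSolver
open import Data.List using (List; []; _∷_; _++_; map; concatMap; length; upTo; applyUpTo)
open import Data.List.Properties using (≡-dec; length-++)
open import Data.List.Relation.Unary.All as All using (All; []; _∷_)
import Data.List.Relation.Unary.All.Properties as AllP
open import Data.Nat as ℕ using (ℕ; zero; suc; _∸_; _≤_; _<_; z≤n; s≤s)
open import Data.Nat.ListAction renaming (sum to sumℕ)
open import Data.Nat.ListAction.Properties using (sum-++)
import Data.Nat.Properties as ℕP
import Data.Nat.Solver as ℕSolver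
open import Data.Product using (_×_; _,_; proj₁; proj₂)
open import Data.Rational as ℚ using (ℚ; 0ℚ; 1ℚ; _+_; _*_; -_; _-_; fromℚᵘ)
import Data.Rational.Properties as ℚP
open import Data.Rational.Solver using (module +-*-Solver)
import Data.Rational.Unnormalised as U
import Data.Rational.Unnormalised.Properties as UP
open import Data.Sum using (inj₁; inj₂)
open import Data.Unit using (⊤; tt)
open import Relation.Binary.PropositionalEquality
open import Relation.Nullary using (yes; no)

open +-*-Solver using (solve; _:=_; _:+_; _:*_; :-_; _:-_; con)
module ℤS = ℤSolver.+-*-Solver
module ℕS = ℕSolver.+-*-Solver

∑ : {X : Set} → (X → ℚ) → List X → ℚ
∑ F []       = 0ℚ
∑ F (x ∷ xs) = F x + ∑ F xs

∑-++ : ∀ {X : Set} (F : X → ℚ) xs ys → ∑ F (xs ++ ys) ≡ ∑ F xs + ∑ F ys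
∑-++ F []       ys = sym (ℚP.+-identityˡ _)
∑-++ F (x ∷ xs) ys = trans (cong (F x +_) (∑-++ F xs ys)) (sym (ℚP.+-assoc (F x) (∑ F xs) (∑ F ys)))

∑-cong : ∀ {X : Set} {F G : X → ℚ} xs → (∀ x → F x ≡ G x) → ∑ F xs ≡ ∑ G xs
∑-cong []       F≗G = refl
∑-cong (x ∷ xs) F≗G = cong₂ _+_ (F≗G x) (∑-cong xs F≗G)

∑-cong-All : ∀ {X : Set} {P : X → Set} {F G : X → ℚ} {xs} → All P xs → (∀ {x} → P x → F x ≡ G x) → ∑ F xs ≡ ∑ G xs
∑-cong-All []         F≗G = refl
∑-cong-All (px ∷ pxs) F≗G = cong₂ _+_ (F≗G px) (∑-cong-All pxs F≗G)

∑-+ : ∀ {X : Set} (F G : X → ℚ) xs → ∑ (λ x → F x + G x) xs ≡ ∑ F xs + ∑ G xs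
∑-+ F G []       = refl
∑-+ F G (x ∷ xs) rewrite ∑-+ F G xs =
  solve 4 (λ a b c d → (a :+ b) :+ (c :+ d) := (a :+ c) :+ (b :+ d)) refl (F x) (G x) (∑ F xs) (∑ G xs)

∑-neg : ∀ {X : Set} (F : X → ℚ) xs → ∑ (λ x → - F x) xs ≡ - ∑ F xs
∑-neg F []       = refl
∑-neg F (x ∷ xs) rewrite ∑-neg F xs = solve 2 (λ a b → (:- a) :+ (:- b) := :- (a :+ b)) refl (F x) (∑ F xs)

*-distribˡ-∑ : ∀ {X : Set} c (F : X → ℚ) xs → c * ∑ F xs ≡ ∑ (λ x → c * F x) xs
*-distribˡ-∑ c F []       = ℚP.*-zeroʳ c
*-distribˡ-∑ c F (x ∷ xs) = trans (ℚP.*-distribˡ-+ c (F x) (∑ F xs)) (cong (c * F x +_) (*-distribˡ-∑ c F xs))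

∑-0 : ∀ {X : Set} (xs : List X) → ∑ (λ _ → 0ℚ) xs ≡ 0ℚ
∑-0 []       = refl
∑-0 (x ∷ xs) = trans (ℚP.+-identityˡ _) (∑-0 xs)

∑-map : ∀ {X Y : Set} (F : Y → ℚ) (h : X → Y) xs → ∑ F (map h xs) ≡ ∑ (λ x → F (h x)) xs
∑-map F h []       = refl
∑-map F h (x ∷ xs) = cong (F (h x) +_) (∑-map F h xs)

∑-concatMap : ∀ {X Y : Set} (F : Y → ℚ) (h : X → List Y) xs →
              ∑ F (concatMap h xs) ≡ ∑ (λ x → ∑ F (h x)) xs
∑-concatMap F h []       = refl
∑-concatMap F h (x ∷ xs) = trans (∑-++ F (h x) _) (cong (∑ F (h x) +_) (∑-concatMap F h xs))

∑-swap : ∀ {X Y : Set} (F : X → Y → ℚ) xs ys →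
         ∑ (λ x → ∑ (F x) ys) xs ≡ ∑ (λ y → ∑ (λ x → F x y) xs) ys
∑-swap F []       ys = sym (∑-0 ys)
∑-swap F (x ∷ xs) ys =
  trans (cong (∑ (F x) ys +_) (∑-swap F xs ys)) (sym (∑-+ (F x) (λ y → ∑ (λ x → F x y) xs) ys))

∑< : ℕ → (ℕ → ℚ) → ℚ
∑< zero    F = 0ℚ
∑< (suc n) F = ∑< n F + F n

∑<-cong-< : ∀ n {F G : ℕ → ℚ} → (∀ i → i < n → F i ≡ G i) → ∑< n F ≡ ∑< n G
∑<-cong-< zero    F≗G = refl
∑<-cong-< (suc n) F≗G = cong₂ _+_ (∑<-cong-< n (λ i i<n → F≗G i (ℕP.m<n⇒m<1+n i<n))) (F≗G n ℕP.≤-refl)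

∑<-cong : ∀ n {F G : ℕ → ℚ} → (∀ i → F i ≡ G i) → ∑< n F ≡ ∑< n G
∑<-cong n F≗G = ∑<-cong-< n (λ i _ → F≗G i)

∑<-+ : ∀ n (F G : ℕ → ℚ) → ∑< n (λ i → F i + G i) ≡ ∑< n F + ∑< n G
∑<-+ zero    F G = refl
∑<-+ (suc n) F G rewrite ∑<-+ n F G =
  solve 4 (λ a b c d → (a :+ b) :+ (c :+ d) := (a :+ c) :+ (b :+ d)) refl (∑< n F) (∑< n G) (F n) (G n)

∑<-0 : ∀ n → ∑< n (λ _ → 0ℚ) ≡ 0ℚ
∑<-0 zero    = refl
∑<-0 (suc n) = trans (ℚP.+-identityʳ _) (∑<-0 n)

∑<-suc : ∀ n (F : ℕ → ℚ) → ∑< (suc n) F ≡ F 0 + ∑< n (λ i → F (suc i))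
∑<-suc zero    F = trans (ℚP.+-identityˡ (F 0)) (sym (ℚP.+-identityʳ (F 0)))
∑<-suc (suc n) F rewrite ∑<-suc n F = ℚP.+-assoc (F 0) (∑< n (λ i → F (suc i))) (F (suc n))

∑-applyUpTo : ∀ (F : ℕ → ℚ) (h : ℕ → ℕ) n → ∑ F (applyUpTo h n) ≡ ∑< n (λ i → F (h i))
∑-applyUpTo F h zero    = refl
∑-applyUpTo F h (suc n) =
  trans (cong (F (h 0) +_) (∑-applyUpTo F (λ i → h (suc i)) n)) (sym (∑<-suc n (λ i → F (h i))))

∑-upTo : ∀ (F : ℕ → ℚ) n → ∑ F (upTo n) ≡ ∑< n F
∑-upTo F = ∑-applyUpTo F (λ i → i)

ifZero : ℕ → ℚ → ℚ
ifZero zero    x = x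
ifZero (suc _) x = 0ℚ

∑<-ifZero : ∀ m (X : ℕ → ℚ) → ∑< (suc m) (λ e → ifZero (m ∸ e) (X e)) ≡ X m
∑<-ifZero m X = begin
  ∑< m (λ e → ifZero (m ∸ e) (X e)) + ifZero (m ∸ m) (X m)
    ≡⟨ cong₂ _+_ (trans (∑<-cong-< m vanish) (∑<-0 m)) (cong (λ z → ifZero z (X m)) (ℕP.n∸n≡0 m)) ⟩
  0ℚ + X m
    ≡⟨ ℚP.+-identityˡ _ ⟩
  X m ∎
  where
  vanish : ∀ e → e < m → ifZero (m ∸ e) (X e) ≡ 0ℚ
  vanish e e<m with m ∸ e | ℕP.m>n⇒m∸n≢0 e<m
  ... | zero  | m∸e≢0 = ⊥-elim (m∸e≢0 refl)
  ... | suc _ | _     = refl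
  open ≡-Reasoning

-- atPred Y m = Y (m - 1), with Y (-1) = 0 as for G_{-1} = 0

atPred : (ℕ → ℚ) → ℕ → ℚ
atPred Y zero    = 0ℚ
atPred Y (suc n) = Y n

atPred-cong : ∀ {Y Z : ℕ → ℚ} m → (∀ n → Y n ≡ Z n) → atPred Y m ≡ atPred Z m
atPred-cong zero    Y≗Z = refl
atPred-cong (suc m) Y≗Z = Y≗Z m

atPred-+ : ∀ (Y Z : ℕ → ℚ) m → atPred (λ n → Y n + Z n) m ≡ atPred Y m + atPred Z m
atPred-+ Y Z zero    = sym (ℚP.+-identityʳ 0ℚ)
atPred-+ Y Z (suc m) = refl

atPred-neg : ∀ (Y : ℕ → ℚ) m → atPred (λ n → - Y n) m ≡ - atPred Y m
atPred-neg Y zero    = refl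
atPred-neg Y (suc m) = refl

∑-atPred : ∀ {X : Set} (Y : X → ℕ → ℚ) xs m → ∑ (λ x → atPred (Y x) m) xs ≡ atPred (λ n → ∑ (λ x → Y x n) xs) m
∑-atPred Y xs zero    = ∑-0 xs
∑-atPred Y xs (suc m) = refl

∑<-atPred : ∀ m (Y : ℕ → ℕ → ℚ) →
            ∑< (suc m) (λ e → atPred (Y e) (m ∸ e)) ≡ atPred (λ n → ∑< (suc n) (λ e → Y e (n ∸ e))) m
∑<-atPred zero    Y = ℚP.+-identityˡ 0ℚ
∑<-atPred (suc m) Y =
  trans (cong₂ _+_ (∑<-cong-< (suc m) (λ e e<1+m → cong (atPred (Y e)) (ℕP.+-∸-assoc 1 (ℕP.≤-pred e<1+m))))
                   (cong (atPred (Y (suc m))) (ℕP.n∸n≡0 m)))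
        (ℚP.+-identityʳ _)

-- Binomial coefficients

ι : ℤ → ℚ
ι z = z ℚ./ 1

fromℚᵘ-homo-* : ∀ p q → fromℚᵘ (p U.* q) ≡ fromℚᵘ p * fromℚᵘ q
fromℚᵘ-homo-* p q = ℚP.toℚᵘ-injective (UP.≃-trans (ℚP.toℚᵘ-fromℚᵘ (p U.* q))
  (UP.≃-sym (UP.≃-trans (ℚP.toℚᵘ-homo-* (fromℚᵘ p) (fromℚᵘ q)) (UP.*-cong (ℚP.toℚᵘ-fromℚᵘ p) (ℚP.toℚᵘ-fromℚᵘ q)))))

fromℚᵘ-homo-+ : ∀ p q → fromℚᵘ (p U.+ q) ≡ fromℚᵘ p + fromℚᵘ q
fromℚᵘ-homo-+ p q = ℚP.toℚᵘ-injective (UP.≃-trans (ℚP.toℚᵘ-fromℚᵘ (p U.+ q))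
  (UP.≃-sym (UP.≃-trans (ℚP.toℚᵘ-homo-+ (fromℚᵘ p) (fromℚᵘ q)) (UP.+-cong (ℚP.toℚᵘ-fromℚᵘ p) (ℚP.toℚᵘ-fromℚᵘ q)))))

ι-homo-* : ∀ a b → ι (a ℤ.* b) ≡ ι a * ι b
ι-homo-* a b = fromℚᵘ-homo-* (U.mkℚᵘ a 0) (U.mkℚᵘ b 0)

ι-homo-+ : ∀ a b → ι (a ℤ.+ b) ≡ ι a + ι b
ι-homo-+ a b =
  trans (ℚP.fromℚᵘ-cong {U.mkℚᵘ (a ℤ.+ b) 0} {U.mkℚᵘ a 0 U.+ U.mkℚᵘ b 0} (U.*≡* (ℤS.solve 2 (λ a b → (a ℤS.:+ b) ℤS.:* ℤS.con (ℤ.+ 1)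
                         ℤS.:= (a ℤS.:* ℤS.con (ℤ.+ 1) ℤS.:+ b ℤS.:* ℤS.con (ℤ.+ 1)) ℤS.:* ℤS.con (ℤ.+ 1)) refl a b)))
                     (fromℚᵘ-homo-+ (U.mkℚᵘ a 0) (U.mkℚᵘ b 0))

1/[1+_] : ℕ → ℚ
1/[1+ n ] = ℤ.+ 1 ℚ./ suc n

z/[1+n]≡z*1/[1+n] : ∀ z n → z ℚ./ suc n ≡ ι z * 1/[1+ n ]
z/[1+n]≡z*1/[1+n] z n =
  trans (ℚP.fromℚᵘ-cong {U.mkℚᵘ z n} {U.mkℚᵘ z 0 U.* U.mkℚᵘ (ℤ.+ 1) n} (U.*≡* eq))
        (fromℚᵘ-homo-* (U.mkℚᵘ z 0) (U.mkℚᵘ (ℤ.+ 1) n))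
  where
  eq : z ℤ.* ℤ.+ (1 ℕ.* suc n) ≡ (z ℤ.* ℤ.+ 1) ℤ.* ℤ.+ suc n
  eq rewrite ℕP.*-identityˡ (suc n) | ℤP.*-identityʳ z = refl

1/[1+n]*[1+n]≡1 : ∀ n → 1/[1+ n ] * ι (ℤ.+ suc n) ≡ 1ℚ
1/[1+n]*[1+n]≡1 n = trans (sym (fromℚᵘ-homo-* (U.mkℚᵘ (ℤ.+ 1) n) (U.mkℚᵘ (ℤ.+ suc n) 0)))
                          (ℚP.fromℚᵘ-cong {U.mkℚᵘ (ℤ.+ 1) n U.* U.mkℚᵘ (ℤ.+ suc n) 0} {U.mkℚᵘ (ℤ.+ 1) 0}
                            (U.*≡* (cong (λ x → ℤ.+ suc x) [n+0]*1≡n*1+0)))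
  where
  [n+0]*1≡n*1+0 : (n ℕ.+ 0) ℕ.* 1 ≡ n ℕ.* 1 ℕ.+ 0
  [n+0]*1≡n*1+0 = trans (cong (ℕ._* 1) (ℕP.+-identityʳ n)) (sym (ℕP.+-identityʳ _))

fallingFactorial : ℤ → ℕ → ℤ
fallingFactorial n zero    = ℤ.+ 1
fallingFactorial n (suc j) = fallingFactorial n j ℤ.* (n ℤ.- ℤ.+ j)

1/_! : ℕ → ℚ
1/ zero  ! = 1ℚ
1/ suc j ! = 1/ j ! * 1/[1+ j ]

binom≡falling*1/! : ∀ n j → binom n j ≡ ι (fallingFactorial n j) * 1/ j !
binom≡falling*1/! n zero    = sym (ℚP.*-identityʳ 1ℚ)
binom≡falling*1/! n (suc j)
  rewrite binom≡falling*1/! n j | z/[1+n]≡z*1/[1+n] (n ℤ.- ℤ.+ j) j | ι-homo-* (fallingFactorial n j) (n ℤ.- ℤ.+ j) =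
  solve 4 (λ a b c d → (a :* b) :* (c :* d) := (a :* c) :* (b :* d)) refl
    (ι (fallingFactorial n j)) (1/ j !) (ι (n ℤ.- ℤ.+ j)) 1/[1+ j ]

fallingFactorial-pascal : ∀ n j →
  fallingFactorial (n ℤ.+ ℤ.+ 1) (suc j) ≡ fallingFactorial n (suc j) ℤ.+ ℤ.+ suc j ℤ.* fallingFactorial n j
fallingFactorial-pascal n zero = ℤS.solve 1 (λ n → ℤS.con (ℤ.+ 1) ℤS.:* ((n ℤS.:+ ℤS.con (ℤ.+ 1)) ℤS.:- ℤS.con (ℤ.+ 0))
  ℤS.:= ℤS.con (ℤ.+ 1) ℤS.:* (n ℤS.:- ℤS.con (ℤ.+ 0)) ℤS.:+ ℤS.con (ℤ.+ 1) ℤS.:* ℤS.con (ℤ.+ 1)) refl n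
fallingFactorial-pascal n (suc j) rewrite fallingFactorial-pascal n j =
  ℤS.solve 3 (λ n J A → (A ℤS.:* (n ℤS.:- J) ℤS.:+ (ℤS.con (ℤ.+ 1) ℤS.:+ J) ℤS.:* A)
                         ℤS.:* ((n ℤS.:+ ℤS.con (ℤ.+ 1)) ℤS.:- (ℤS.con (ℤ.+ 1) ℤS.:+ J))
     ℤS.:= A ℤS.:* (n ℤS.:- J) ℤS.:* (n ℤS.:- (ℤS.con (ℤ.+ 1) ℤS.:+ J)) ℤS.:+ (ℤS.con (ℤ.+ 2) ℤS.:+ J) ℤS.:* (A ℤS.:* (n ℤS.:- J)))
    refl n (ℤ.+ j) (fallingFactorial n j)

binom-pascal : ∀ n j → binom (n ℤ.+ ℤ.+ 1) (suc j) ≡ binom n (suc j) + binom n j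
binom-pascal n j
  rewrite binom≡falling*1/! (n ℤ.+ ℤ.+ 1) (suc j) | binom≡falling*1/! n (suc j) | binom≡falling*1/! n j
        | fallingFactorial-pascal n j | ι-homo-+ (fallingFactorial n (suc j)) (ℤ.+ suc j ℤ.* fallingFactorial n j)
        | ι-homo-* (ℤ.+ suc j) (fallingFactorial n j) =
  trans (solve 5 (λ a b c d e → (a :+ b :* c) :* (d :* e) := a :* (d :* e) :+ c :* d :* (e :* b)) refl
           (ι (fallingFactorial n (suc j))) (ι (ℤ.+ suc j)) (ι (fallingFactorial n j)) (1/ j !) 1/[1+ j ])
        (cong (ι (fallingFactorial n (suc j)) * (1/ j ! * 1/[1+ j ]) +_)
              (trans (cong (ι (fallingFactorial n j) * 1/ j ! *_) (1/[1+n]*[1+n]≡1 j)) (ℚP.*-identityʳ _)))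

i>x⇒binom≡0 : ∀ x i → x < i → binom (ℤ.+ x) i ≡ 0ℚ
i>x⇒binom≡0 x (suc i) x<1+i with ℕP.m≤n⇒m<n∨m≡n (ℕP.≤-pred x<1+i)
... | inj₁ x<i = trans (cong (_* ((ℤ.+ x ℤ.- ℤ.+ i) ℚ./ suc i)) (i>x⇒binom≡0 x i x<i)) (ℚP.*-zeroˡ ((ℤ.+ x ℤ.- ℤ.+ i) ℚ./ suc i))
... | inj₂ refl = trans (cong (binom (ℤ.+ x) x *_) (trans (cong (λ z → z ℚ./ suc x) (ℤP.+-inverseʳ (ℤ.+ x))) (ℚP.0/n≡0 (suc x))))
                        (ℚP.*-zeroʳ (binom (ℤ.+ x) x))

-- Polynomials act on sequences, t shifting the index. Poly has no normal form, so
-- polynomials are compared through this action (_≐_).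

Seq : Set
Seq = ℕ → ℚ

infixr 6 _▷_
_▷_ : Poly → Seq → Seq
(p ▷ s) j = ∑ (λ ai → proj₁ ai * s (proj₂ ai ℕ.+ j)) p

infix 4 _≐_
_≐_ : Poly → Poly → Set
p ≐ q = ∀ s j → (p ▷ s) j ≡ (q ▷ s) j

▷-cong : ∀ p {s s′ : Seq} → (∀ j → s j ≡ s′ j) → ∀ j → (p ▷ s) j ≡ (p ▷ s′) j
▷-cong p s≗s′ j = ∑-cong p (λ ai → cong (proj₁ ai *_) (s≗s′ _))

▷-++ : ∀ p q (s : Seq) j → ((p ++ q) ▷ s) j ≡ (p ▷ s) j + (q ▷ s) j
▷-++ p q s j = ∑-++ _ p q

▷-+ : ∀ p (s s′ : Seq) j → (p ▷ (λ i → s i + s′ i)) j ≡ (p ▷ s) j + (p ▷ s′) j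
▷-+ p s s′ j = trans (∑-cong p (λ ai → ℚP.*-distribˡ-+ (proj₁ ai) _ _)) (∑-+ _ _ p)

▷-∑< : ∀ p n (F : ℕ → Seq) j → (p ▷ (λ i → ∑< n (λ x → F x i))) j ≡ ∑< n (λ x → (p ▷ F x) j)
▷-∑< p zero    F j = trans (∑-cong p (λ ai → ℚP.*-zeroʳ (proj₁ ai))) (∑-0 p)
▷-∑< p (suc n) F j = trans (▷-+ p (λ i → ∑< n (λ x → F x i)) (F n) j) (cong (_+ (p ▷ F n) j) (▷-∑< p n F j))

▷-suc : ∀ p (s : Seq) j → (p ▷ s) (suc j) ≡ (p ▷ (λ i → s (suc i))) j
▷-suc p s j = ∑-cong p (λ ai → cong (λ z → proj₁ ai * s z) (ℕP.+-suc (proj₂ ai) j))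

▷-polyMul : ∀ p q (s : Seq) j → (polyMul p q ▷ s) j ≡ (p ▷ (q ▷ s)) j
▷-polyMul []            q s j = refl
▷-polyMul ((a , i) ∷ p) q s j =
  trans (∑-++ _ (map _ q) (polyMul p q)) (cong₂ _+_ monomial (▷-polyMul p q s j))
  where
  shuffle : ∀ k → (i ℕ.+ k) ℕ.+ j ≡ k ℕ.+ (i ℕ.+ j)
  shuffle k = trans (ℕP.+-assoc i k j) (trans (ℕP.+-comm i (k ℕ.+ j)) (trans (ℕP.+-assoc k j i) (cong (k ℕ.+_) (ℕP.+-comm j i))))
  monomial : ∑ _ (map _ q) ≡ a * (q ▷ s) (i ℕ.+ j)
  monomial = begin
    ∑ _ (map _ q)
      ≡⟨ ∑-map _ _ q ⟩
    ∑ (λ bk → (a * proj₁ bk) * s ((i ℕ.+ proj₂ bk) ℕ.+ j)) q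
      ≡⟨ ∑-cong q (λ bk → trans (ℚP.*-assoc a (proj₁ bk) _) (cong (λ z → a * (proj₁ bk * s z)) (shuffle (proj₂ bk)))) ⟩
    ∑ (λ bk → a * (proj₁ bk * s (proj₂ bk ℕ.+ (i ℕ.+ j)))) q
      ≡⟨ *-distribˡ-∑ a _ q ⟨
    a * (q ▷ s) (i ℕ.+ j) ∎
    where open ≡-Reasoning

▷-comm : ∀ p q (s : Seq) j → (p ▷ (q ▷ s)) j ≡ (q ▷ (p ▷ s)) j
▷-comm p q s j = begin
  ∑ (λ ai → proj₁ ai * ∑ (λ bk → proj₁ bk * s (proj₂ bk ℕ.+ (proj₂ ai ℕ.+ j))) q) p
    ≡⟨ ∑-cong p (λ ai → *-distribˡ-∑ (proj₁ ai) _ q) ⟩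
  ∑ (λ ai → ∑ (λ bk → proj₁ ai * (proj₁ bk * s (proj₂ bk ℕ.+ (proj₂ ai ℕ.+ j)))) q) p
    ≡⟨ ∑-swap _ p q ⟩
  ∑ (λ bk → ∑ (λ ai → proj₁ ai * (proj₁ bk * s (proj₂ bk ℕ.+ (proj₂ ai ℕ.+ j)))) p) q
    ≡⟨ ∑-cong q (λ bk → ∑-cong p (λ ai → swap (proj₁ ai) (proj₁ bk) (proj₂ ai) (proj₂ bk))) ⟩
  ∑ (λ bk → ∑ (λ ai → proj₁ bk * (proj₁ ai * s (proj₂ ai ℕ.+ (proj₂ bk ℕ.+ j)))) p) q
    ≡⟨ ∑-cong q (λ bk → *-distribˡ-∑ (proj₁ bk) _ p) ⟨
  ∑ (λ bk → proj₁ bk * ∑ (λ ai → proj₁ ai * s (proj₂ ai ℕ.+ (proj₂ bk ℕ.+ j))) p) q ∎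
  where
  open ≡-Reasoning
  swap : ∀ a b i k → a * (b * s (k ℕ.+ (i ℕ.+ j))) ≡ b * (a * s (i ℕ.+ (k ℕ.+ j)))
  swap a b i k = trans (sym (ℚP.*-assoc a b _))
    (trans (cong₂ _*_ (ℚP.*-comm a b)
                      (cong s (trans (sym (ℕP.+-assoc k i j)) (trans (cong (ℕ._+ j) (ℕP.+-comm k i)) (ℕP.+-assoc i k j)))))
           (ℚP.*-assoc b a _))

▷-one : ∀ (s : Seq) j → (((1ℚ , 0) ∷ []) ▷ s) j ≡ s j
▷-one s j = trans (ℚP.+-identityʳ _) (ℚP.*-identityˡ _)

▷-t : ∀ (s : Seq) j → (t ▷ s) j ≡ s (suc j)
▷-t s j = trans (ℚP.+-identityʳ _) (ℚP.*-identityˡ _)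

▷-oneMinusT : ∀ (s : Seq) j → (oneMinusT ▷ s) j ≡ s j - s (suc j)
▷-oneMinusT s j = solve 2 (λ a b → con 1ℚ :* a :+ (con (- 1ℚ) :* b :+ con 0ℚ) := a :- b) refl (s j) (s (suc j))

▷-minusTOneMinusT : ∀ (s : Seq) j → (minusTOneMinusT ▷ s) j ≡ - (oneMinusT ▷ s) (suc j)
▷-minusTOneMinusT s j = trans (▷-polyMul ((- 1ℚ , 1) ∷ []) oneMinusT s j)
  (solve 1 (λ a → con (- 1ℚ) :* a :+ con 0ℚ := :- a) refl ((oneMinusT ▷ s) (suc j)))

-- The polynomials f_i(k,e)

upperArg : ℕ → ℤ → ℕ → ℤ
upperArg i k e = (k ℤ.+ ℤ.+ e) ℤ.- ℤ.+ (i ℕ.+ 2)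

fCoeff : ℕ → ℤ → ℕ → ℕ → ℚ
fCoeff i k e j = binom (ℤ.+ (e ∸ j)) i * binom (upperArg i k e) j

fSum : ℕ → ℤ → ℕ → Seq → Seq
fSum i k e s n = ∑< (suc e) (λ j → fCoeff i k e j * (polyPow oneMinusT (e ∸ i ∸ j) ▷ s) (j ℕ.+ n))

f▷≡fSum : ∀ i k e s n → (f i k e ▷ s) n ≡ fSum i k e s n
f▷≡fSum i k e s n = begin
  (f i k e ▷ s) n
    ≡⟨ ∑-concatMap _ (λ j → polyMul ((fCoeff i k e j , j) ∷ []) (polyPow oneMinusT (e ∸ i ∸ j))) (upTo (suc e)) ⟩
  ∑ (λ j → (polyMul ((fCoeff i k e j , j) ∷ []) (polyPow oneMinusT (e ∸ i ∸ j)) ▷ s) n) (upTo (suc e))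
    ≡⟨ ∑-upTo _ (suc e) ⟩
  ∑< (suc e) (λ j → (polyMul ((fCoeff i k e j , j) ∷ []) (polyPow oneMinusT (e ∸ i ∸ j)) ▷ s) n)
    ≡⟨ ∑<-cong (suc e) (λ j → trans (▷-polyMul ((fCoeff i k e j , j) ∷ []) (polyPow oneMinusT (e ∸ i ∸ j)) s n)
                                    (ℚP.+-identityʳ _)) ⟩
  fSum i k e s n ∎
  where open ≡-Reasoning

upperArg[i,k+1,1+e]≡upperArg[i,k,1+e]+1 : ∀ i k e → upperArg i (k ℤ.+ ℤ.+ 1) (suc e) ≡ upperArg i k (suc e) ℤ.+ ℤ.+ 1
upperArg[i,k+1,1+e]≡upperArg[i,k,1+e]+1 i k e = ℤS.solve 3 (λ k e i →
  ((k ℤS.:+ ℤS.con (ℤ.+ 1)) ℤS.:+ (ℤS.con (ℤ.+ 1) ℤS.:+ e)) ℤS.:- (i ℤS.:+ ℤS.con (ℤ.+ 2))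
  ℤS.:= ((k ℤS.:+ (ℤS.con (ℤ.+ 1) ℤS.:+ e)) ℤS.:- (i ℤS.:+ ℤS.con (ℤ.+ 2))) ℤS.:+ ℤS.con (ℤ.+ 1)) refl k (ℤ.+ e) (ℤ.+ i)

upperArg[i,k+1,e]≡upperArg[i,k,1+e] : ∀ i k e → upperArg i (k ℤ.+ ℤ.+ 1) e ≡ upperArg i k (suc e)
upperArg[i,k+1,e]≡upperArg[i,k,1+e] i k e = ℤS.solve 3 (λ k e i →
  ((k ℤS.:+ ℤS.con (ℤ.+ 1)) ℤS.:+ e) ℤS.:- (i ℤS.:+ ℤS.con (ℤ.+ 2))
  ℤS.:= (k ℤS.:+ (ℤS.con (ℤ.+ 1) ℤS.:+ e)) ℤS.:- (i ℤS.:+ ℤS.con (ℤ.+ 2))) refl k (ℤ.+ e) (ℤ.+ i)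

upperArg[1+i,k,1+e]≡upperArg[i,k,e] : ∀ i k e → upperArg (suc i) k (suc e) ≡ upperArg i k e
upperArg[1+i,k,1+e]≡upperArg[i,k,e] i k e = ℤS.solve 3 (λ k e i →
  (k ℤS.:+ (ℤS.con (ℤ.+ 1) ℤS.:+ e)) ℤS.:- (ℤS.con (ℤ.+ 1) ℤS.:+ i ℤS.:+ ℤS.con (ℤ.+ 2))
  ℤS.:= (k ℤS.:+ e) ℤS.:- (i ℤS.:+ ℤS.con (ℤ.+ 2))) refl k (ℤ.+ e) (ℤ.+ i)

upperArg[1+i,k+2,e]≡upperArg[i,k+1,e] : ∀ i k e → upperArg (suc i) (k ℤ.+ ℤ.+ 2) e ≡ upperArg i (k ℤ.+ ℤ.+ 1) e
upperArg[1+i,k+2,e]≡upperArg[i,k+1,e] i k e = ℤS.solve 3 (λ k e i →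
  ((k ℤS.:+ ℤS.con (ℤ.+ 2)) ℤS.:+ e) ℤS.:- (ℤS.con (ℤ.+ 1) ℤS.:+ i ℤS.:+ ℤS.con (ℤ.+ 2))
  ℤS.:= ((k ℤS.:+ ℤS.con (ℤ.+ 1)) ℤS.:+ e) ℤS.:- (i ℤS.:+ ℤS.con (ℤ.+ 2))) refl k (ℤ.+ e) (ℤ.+ i)

fSum-pascalᵏ : ∀ i K e s n → fSum i (K ℤ.+ ℤ.+ 1) (suc e) s n ≡ fSum i K (suc e) s n + fSum i (K ℤ.+ ℤ.+ 1) e s (suc n)
fSum-pascalᵏ i K e s n = begin
  ∑< (suc (suc e)) L
    ≡⟨ ∑<-suc (suc e) L ⟩
  M 0 + ∑< (suc e) (λ j → L (suc j))
    ≡⟨ cong (M 0 +_) (trans (∑<-cong (suc e) split) (∑<-+ (suc e) (λ j → M (suc j)) T)) ⟩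
  M 0 + (∑< (suc e) (λ j → M (suc j)) + ∑< (suc e) T)
    ≡⟨ ℚP.+-assoc (M 0) _ _ ⟨
  (M 0 + ∑< (suc e) (λ j → M (suc j))) + ∑< (suc e) T
    ≡⟨ cong (_+ ∑< (suc e) T) (∑<-suc (suc e) M) ⟨
  ∑< (suc (suc e)) M + ∑< (suc e) T ∎
  where
  open ≡-Reasoning
  N = upperArg i K (suc e)
  P : ℕ → Seq
  P r = polyPow oneMinusT r ▷ s
  L M T : ℕ → ℚ
  L j = fCoeff i (K ℤ.+ ℤ.+ 1) (suc e) j * P (suc e ∸ i ∸ j) (j ℕ.+ n)
  M j = fCoeff i K (suc e) j * P (suc e ∸ i ∸ j) (j ℕ.+ n)
  T j = fCoeff i (K ℤ.+ ℤ.+ 1) e j * P (e ∸ i ∸ j) (j ℕ.+ suc n)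
  split : ∀ j → L (suc j) ≡ M (suc j) + T j
  split j rewrite upperArg[i,k+1,1+e]≡upperArg[i,k,1+e]+1 i K e | binom-pascal N j | upperArg[i,k+1,e]≡upperArg[i,k,1+e] i K e
                | ℕP.∸-+-assoc (suc e) i (suc j) | ℕP.+-suc i j | ℕP.∸-+-assoc e i j | ℕP.+-suc j n =
    solve 4 (λ a b c x → a :* (b :+ c) :* x := a :* b :* x :+ a :* c :* x) refl
      (binom (ℤ.+ (e ∸ j)) i) (binom N (suc j)) (binom N j) (P (e ∸ (i ℕ.+ j)) (suc (j ℕ.+ n)))

i<x⇒x∸i≡1+[x∸1+i] : ∀ x i → i < x → x ∸ i ≡ suc (x ∸ suc i)
i<x⇒x∸i≡1+[x∸1+i] (suc x) zero    _         = refl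
i<x⇒x∸i≡1+[x∸1+i] (suc x) (suc i) (s≤s i<x) = i<x⇒x∸i≡1+[x∸1+i] x i i<x

binom*[1-t]^[x∸i]≡binom*[1-t]^[x∸1+i]∘[1-t] : ∀ x i s m →
  binom (ℤ.+ x) (suc i) * (polyPow oneMinusT (x ∸ i) ▷ s) m ≡ binom (ℤ.+ x) (suc i) * (polyPow oneMinusT (x ∸ suc i) ▷ (oneMinusT ▷ s)) m
binom*[1-t]^[x∸i]≡binom*[1-t]^[x∸1+i]∘[1-t] x i s m with suc i ℕP.≤? x
... | yes 1+i≤x rewrite i<x⇒x∸i≡1+[x∸1+i] x i 1+i≤x =
  cong (binom (ℤ.+ x) (suc i) *_)
       (trans (▷-polyMul oneMinusT (polyPow oneMinusT (x ∸ suc i)) s m) (▷-comm oneMinusT (polyPow oneMinusT (x ∸ suc i)) s m))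
... | no 1+i≰x rewrite i>x⇒binom≡0 x (suc i) (ℕP.≰⇒> 1+i≰x) =
  trans (ℚP.*-zeroˡ ((polyPow oneMinusT (x ∸ i) ▷ s) m)) (sym (ℚP.*-zeroˡ ((polyPow oneMinusT (x ∸ suc i) ▷ (oneMinusT ▷ s)) m)))

fSum-pascalⁱ : ∀ i K e s n →
  fSum (suc i) (K ℤ.+ ℤ.+ 1) (suc e) s n ≡ fSum i (K ℤ.+ ℤ.+ 1) e s n + fSum (suc i) (K ℤ.+ ℤ.+ 2) e (oneMinusT ▷ s) n
fSum-pascalⁱ i K e s n = begin
  ∑< (suc e) L + L (suc e)
    ≡⟨ cong₂ _+_ (∑<-cong-< (suc e) split) top ⟩
  ∑< (suc e) (λ j → T₁ j + T₂ j) + 0ℚ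
    ≡⟨ ℚP.+-identityʳ _ ⟩
  ∑< (suc e) (λ j → T₁ j + T₂ j)
    ≡⟨ ∑<-+ (suc e) T₁ T₂ ⟩
  ∑< (suc e) T₁ + ∑< (suc e) T₂ ∎
  where
  open ≡-Reasoning
  N = upperArg i (K ℤ.+ ℤ.+ 1) e
  P : ℕ → Seq → Seq
  P r s = polyPow oneMinusT r ▷ s
  L T₁ T₂ : ℕ → ℚ
  L j  = fCoeff (suc i) (K ℤ.+ ℤ.+ 1) (suc e) j * P (suc e ∸ suc i ∸ j) s (j ℕ.+ n)
  T₁ j = fCoeff i (K ℤ.+ ℤ.+ 1) e j * P (e ∸ i ∸ j) s (j ℕ.+ n)
  T₂ j = fCoeff (suc i) (K ℤ.+ ℤ.+ 2) e j * P (e ∸ suc i ∸ j) (oneMinusT ▷ s) (j ℕ.+ n)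
  top : L (suc e) ≡ 0ℚ
  top rewrite ℕP.n∸n≡0 e | i>x⇒binom≡0 0 (suc i) (s≤s z≤n) =
    trans (cong (_* P (suc e ∸ suc i ∸ suc e) s (suc e ℕ.+ n)) (ℚP.*-zeroˡ (binom (upperArg (suc i) (K ℤ.+ ℤ.+ 1) (suc e)) (suc e))))
          (ℚP.*-zeroˡ (P (suc e ∸ suc i ∸ suc e) s (suc e ℕ.+ n)))
  ∸-comm : ∀ e i j → e ∸ i ∸ j ≡ e ∸ j ∸ i
  ∸-comm e i j = trans (ℕP.∸-+-assoc e i j) (trans (cong (e ∸_) (ℕP.+-comm i j)) (sym (ℕP.∸-+-assoc e j i)))
  split : ∀ j → j < suc e → L j ≡ T₁ j + T₂ j
  split j j<1+e rewrite ℕP.+-∸-assoc 1 (ℕP.≤-pred j<1+e) | ℕP.+-comm 1 (e ∸ j) | binom-pascal (ℤ.+ (e ∸ j)) i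
                      | upperArg[1+i,k,1+e]≡upperArg[i,k,e] i (K ℤ.+ ℤ.+ 1) e | upperArg[1+i,k+2,e]≡upperArg[i,k+1,e] i K e
                      | ∸-comm e i j | ∸-comm e (suc i) j =
    trans (solve 4 (λ a b c x → (a :+ b) :* c :* x := b :* c :* x :+ c :* (a :* x)) refl
             (binom (ℤ.+ (e ∸ j)) (suc i)) (binom (ℤ.+ (e ∸ j)) i) (binom N j) (P (e ∸ j ∸ i) s (j ℕ.+ n)))
     (cong (binom (ℤ.+ (e ∸ j)) i * binom N j * P (e ∸ j ∸ i) s (j ℕ.+ n) +_)
       (trans (cong (binom N j *_) (binom*[1-t]^[x∸i]≡binom*[1-t]^[x∸1+i]∘[1-t] (e ∸ j) i s (j ℕ.+ n)))
          (solve 3 (λ c a y → c :* (a :* y) := a :* c :* y) refl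
             (binom N j) (binom (ℤ.+ (e ∸ j)) (suc i)) (P (e ∸ j ∸ suc i) (oneMinusT ▷ s) (j ℕ.+ n)))))

f-pascalᵏ : ∀ i K e → f i (K ℤ.+ ℤ.+ 1) (suc e) ≐ f i K (suc e) ++ polyMul (f i (K ℤ.+ ℤ.+ 1) e) t
f-pascalᵏ i K e s n = begin
  (f i (K ℤ.+ ℤ.+ 1) (suc e) ▷ s) n
    ≡⟨ f▷≡fSum i (K ℤ.+ ℤ.+ 1) (suc e) s n ⟩
  fSum i (K ℤ.+ ℤ.+ 1) (suc e) s n
    ≡⟨ fSum-pascalᵏ i K e s n ⟩
  fSum i K (suc e) s n + fSum i (K ℤ.+ ℤ.+ 1) e s (suc n)
    ≡⟨ cong₂ _+_ (f▷≡fSum i K (suc e) s n) (f▷≡fSum i (K ℤ.+ ℤ.+ 1) e s (suc n)) ⟨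
  (f i K (suc e) ▷ s) n + (f i (K ℤ.+ ℤ.+ 1) e ▷ s) (suc n)
    ≡⟨ cong ((f i K (suc e) ▷ s) n +_) shifted ⟩
  (f i K (suc e) ▷ s) n + (polyMul (f i (K ℤ.+ ℤ.+ 1) e) t ▷ s) n
    ≡⟨ ▷-++ (f i K (suc e)) (polyMul (f i (K ℤ.+ ℤ.+ 1) e) t) s n ⟨
  ((f i K (suc e) ++ polyMul (f i (K ℤ.+ ℤ.+ 1) e) t) ▷ s) n ∎
  where
  open ≡-Reasoning
  p = f i (K ℤ.+ ℤ.+ 1) e
  shifted : (p ▷ s) (suc n) ≡ (polyMul p t ▷ s) n
  shifted = trans (▷-suc p s n) (trans (▷-cong p (λ j → sym (▷-t s j)) n) (sym (▷-polyMul p t s n)))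

f-pascalⁱ : ∀ i K e → f (suc i) (K ℤ.+ ℤ.+ 1) (suc e) ≐ f i (K ℤ.+ ℤ.+ 1) e ++ polyMul (f (suc i) (K ℤ.+ ℤ.+ 2) e) oneMinusT
f-pascalⁱ i K e s n = begin
  (f (suc i) (K ℤ.+ ℤ.+ 1) (suc e) ▷ s) n
    ≡⟨ f▷≡fSum (suc i) (K ℤ.+ ℤ.+ 1) (suc e) s n ⟩
  fSum (suc i) (K ℤ.+ ℤ.+ 1) (suc e) s n
    ≡⟨ fSum-pascalⁱ i K e s n ⟩
  fSum i (K ℤ.+ ℤ.+ 1) e s n + fSum (suc i) (K ℤ.+ ℤ.+ 2) e (oneMinusT ▷ s) n
    ≡⟨ cong₂ _+_ (f▷≡fSum i (K ℤ.+ ℤ.+ 1) e s n) (f▷≡fSum (suc i) (K ℤ.+ ℤ.+ 2) e (oneMinusT ▷ s) n) ⟨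
  (f i (K ℤ.+ ℤ.+ 1) e ▷ s) n + (f (suc i) (K ℤ.+ ℤ.+ 2) e ▷ (oneMinusT ▷ s)) n
    ≡⟨ cong ((f i (K ℤ.+ ℤ.+ 1) e ▷ s) n +_) (▷-polyMul (f (suc i) (K ℤ.+ ℤ.+ 2) e) oneMinusT s n) ⟨
  (f i (K ℤ.+ ℤ.+ 1) e ▷ s) n + (polyMul (f (suc i) (K ℤ.+ ℤ.+ 2) e) oneMinusT ▷ s) n
    ≡⟨ ▷-++ (f i (K ℤ.+ ℤ.+ 1) e) (polyMul (f (suc i) (K ℤ.+ ℤ.+ 2) e) oneMinusT) s n ⟨
  ((f i (K ℤ.+ ℤ.+ 1) e ++ polyMul (f (suc i) (K ℤ.+ ℤ.+ 2) e) oneMinusT) ▷ s) n ∎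
  where open ≡-Reasoning

f[1+i,k,0]≐0 : ∀ i k → f (suc i) k 0 ≐ []
f[1+i,k,0]≐0 i k s n rewrite f▷≡fSum (suc i) k 0 s n | i>x⇒binom≡0 0 (suc i) (s≤s z≤n) =
  trans (cong (0ℚ +_) (trans (cong (_* P) (ℚP.*-zeroˡ (binom (upperArg (suc i) k 0) 0))) (ℚP.*-zeroˡ P)))
        (ℚP.+-identityˡ 0ℚ)
  where P = (polyPow oneMinusT (0 ∸ suc i ∸ 0) ▷ s) (0 ℕ.+ n)

f[0,k,0]≐1 : ∀ k → f 0 k 0 ≐ (1ℚ , 0) ∷ []
f[0,k,0]≐1 k s n = trans (f▷≡fSum 0 k 0 s n) (trans (ℚP.+-identityˡ _) (ℚP.*-identityˡ _))

f[i,k,0]≐f[i,k′,0] : ∀ i k k′ → f i k 0 ≐ f i k′ 0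
f[i,k,0]≐f[i,k′,0] i k k′ s n = trans (f▷≡fSum i k 0 s n) (sym (f▷≡fSum i k′ 0 s n))

f[0,1,1+e]≐[1-t]f[0,2,e] : ∀ e → f 0 (ℤ.+ 1) (suc e) ≐ polyMul oneMinusT (f 0 (ℤ.+ 2) e)
f[0,1,1+e]≐[1-t]f[0,2,e] e s n = begin
  (f 0 (ℤ.+ 1) (suc e) ▷ s) n
    ≡⟨ f▷≡fSum 0 (ℤ.+ 1) (suc e) s n ⟩
  ∑< (suc e) L + L (suc e)
    ≡⟨ cong₂ _+_ (∑<-cong-< (suc e) split) top ⟩
  ∑< (suc e) (λ j → (oneMinusT ▷ T j) n) + 0ℚ
    ≡⟨ ℚP.+-identityʳ _ ⟩
  ∑< (suc e) (λ j → (oneMinusT ▷ T j) n)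
    ≡⟨ ▷-∑< oneMinusT (suc e) T n ⟨
  (oneMinusT ▷ (λ m → ∑< (suc e) (λ j → T j m))) n
    ≡⟨ ▷-cong oneMinusT (λ m → f▷≡fSum 0 (ℤ.+ 2) e s m) n ⟨
  (oneMinusT ▷ (f 0 (ℤ.+ 2) e ▷ s)) n
    ≡⟨ ▷-polyMul oneMinusT (f 0 (ℤ.+ 2) e) s n ⟨
  (polyMul oneMinusT (f 0 (ℤ.+ 2) e) ▷ s) n ∎
  where
  open ≡-Reasoning
  P : ℕ → Seq
  P r = polyPow oneMinusT r ▷ s
  L : ℕ → ℚ
  L j = fCoeff 0 (ℤ.+ 1) (suc e) j * P (suc e ∸ 0 ∸ j) (j ℕ.+ n)
  T : ℕ → Seq
  T j m = fCoeff 0 (ℤ.+ 2) e j * P (e ∸ 0 ∸ j) (j ℕ.+ m)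
  top : L (suc e) ≡ 0ℚ
  top = trans (cong (_* P (suc e ∸ 0 ∸ suc e) (suc e ℕ.+ n))
                    (trans (cong (1ℚ *_) (i>x⇒binom≡0 e (suc e) ℕP.≤-refl)) (ℚP.*-zeroʳ 1ℚ)))
              (ℚP.*-zeroˡ (P (suc e ∸ 0 ∸ suc e) (suc e ℕ.+ n)))
  split : ∀ j → j < suc e → L j ≡ (oneMinusT ▷ T j) n
  split j j<1+e = begin
    fCoeff 0 (ℤ.+ 2) e j * P (suc e ∸ j) (j ℕ.+ n)
      ≡⟨ cong (λ r → fCoeff 0 (ℤ.+ 2) e j * P r (j ℕ.+ n)) (ℕP.+-∸-assoc 1 (ℕP.≤-pred j<1+e)) ⟩
    fCoeff 0 (ℤ.+ 2) e j * P (suc (e ∸ j)) (j ℕ.+ n)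
      ≡⟨ cong (fCoeff 0 (ℤ.+ 2) e j *_) (trans (▷-polyMul oneMinusT (polyPow oneMinusT (e ∸ j)) s (j ℕ.+ n))
                                                (▷-oneMinusT (P (e ∸ j)) (j ℕ.+ n))) ⟩
    fCoeff 0 (ℤ.+ 2) e j * (P (e ∸ j) (j ℕ.+ n) - P (e ∸ j) (suc (j ℕ.+ n)))
      ≡⟨ solve 3 (λ c x y → c :* (x :- y) := c :* x :- c :* y) refl (fCoeff 0 (ℤ.+ 2) e j) (P (e ∸ j) (j ℕ.+ n)) (P (e ∸ j) (suc (j ℕ.+ n))) ⟩
    fCoeff 0 (ℤ.+ 2) e j * P (e ∸ j) (j ℕ.+ n) - fCoeff 0 (ℤ.+ 2) e j * P (e ∸ j) (suc (j ℕ.+ n))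
      ≡⟨ cong (λ z → fCoeff 0 (ℤ.+ 2) e j * P (e ∸ j) (j ℕ.+ n) - fCoeff 0 (ℤ.+ 2) e j * P (e ∸ j) z) (ℕP.+-suc j n) ⟨
    T j n - T j (suc n)
      ≡⟨ ▷-oneMinusT (T j) n ⟨
    (oneMinusT ▷ T j) n ∎

f[0,2,e]≐1 : ∀ e → f 0 (ℤ.+ 2) e ≐ (1ℚ , 0) ∷ []
f[0,2,e]≐1 zero    = f[0,k,0]≐1 (ℤ.+ 2)
f[0,2,e]≐1 (suc e) s n = begin
  (f 0 (ℤ.+ 2) (suc e) ▷ s) n
    ≡⟨ f-pascalᵏ 0 (ℤ.+ 1) e s n ⟩
  ((f 0 (ℤ.+ 1) (suc e) ++ polyMul (f 0 (ℤ.+ 2) e) t) ▷ s) n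
    ≡⟨ ▷-++ (f 0 (ℤ.+ 1) (suc e)) (polyMul (f 0 (ℤ.+ 2) e) t) s n ⟩
  (f 0 (ℤ.+ 1) (suc e) ▷ s) n + (polyMul (f 0 (ℤ.+ 2) e) t ▷ s) n
    ≡⟨ cong₂ _+_ (trans (f[0,1,1+e]≐[1-t]f[0,2,e] e s n) (▷-polyMul oneMinusT (f 0 (ℤ.+ 2) e) s n))
                 (▷-polyMul (f 0 (ℤ.+ 2) e) t s n) ⟩
  (oneMinusT ▷ (f 0 (ℤ.+ 2) e ▷ s)) n + (f 0 (ℤ.+ 2) e ▷ (t ▷ s)) n
    ≡⟨ cong₂ _+_ (trans (▷-oneMinusT (f 0 (ℤ.+ 2) e ▷ s) n) (cong₂ _-_ (IH s n) (IH s (suc n))))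
                 (trans (IH (t ▷ s) n) (▷-t s n)) ⟩
  (s n - s (suc n)) + s (suc n)
    ≡⟨ solve 2 (λ a b → (a :- b) :+ b := a) refl (s n) (s (suc n)) ⟩
  s n
    ≡⟨ ▷-one s n ⟨
  (((1ℚ , 0) ∷ []) ▷ s) n ∎
  where
  open ≡-Reasoning
  IH : ∀ s j → (f 0 (ℤ.+ 2) e ▷ s) j ≡ s j
  IH s j = trans (f[0,2,e]≐1 e s j) (▷-one s j)

-- Weights

Weight : Set
Weight = Index → Seq

⟪_⟫ : LC → Weight → ℚ
⟪ A ⟫ w = ∑ (λ x → proj₁ x * w (proj₂ (proj₂ x)) (proj₁ (proj₂ x))) A

infixr 6 _⋆_
_⋆_ : Poly → Weight → Weight
(p ⋆ w) κ = p ▷ w κ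

infixl 6 _⊞_
_⊞_ : Weight → Weight → Weight
(w ⊞ w′) κ j = w κ j + w′ κ j

⊟_ : Weight → Weight
(⊟ w) κ j = - w κ j

infixl 8 _◁_
_◁_ : Weight → ℕ → Weight
(w ◁ a) κ = w (a ∷ κ)

_∘↑ : Weight → Weight
(w ∘↑) κ = w (upI κ)

_∘→′ : Weight → Weight
(w ∘→′) κ = w (κ ++ 1 ∷ [])

It* : Weight → Weight
It* w κ j = ∑ (λ c → w (proj₂ c) (j ℕ.+ proj₁ c)) (combos κ)

⟪⟫-++ : ∀ A B w → ⟪ A ++ B ⟫ w ≡ ⟪ A ⟫ w + ⟪ B ⟫ w
⟪⟫-++ A B w = ∑-++ _ A B

⟪⟫-neg : ∀ A w → ⟪ neg A ⟫ w ≡ - ⟪ A ⟫ w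
⟪⟫-neg A w = trans (∑-map _ _ A) (trans (∑-cong A (λ x → sym (ℚP.neg-distribˡ-* (proj₁ x) _))) (∑-neg _ A))

⟪⟫-mapIdx : ∀ h A w → ⟪ mapIdx h A ⟫ w ≡ ⟪ A ⟫ (λ κ → w (h κ))
⟪⟫-mapIdx h A w = ∑-map _ _ A

⟪⟫-cong : ∀ A {w w′ : Weight} → (∀ κ j → w κ j ≡ w′ κ j) → ⟪ A ⟫ w ≡ ⟪ A ⟫ w′
⟪⟫-cong A w≗w′ = ∑-cong A (λ x → cong (proj₁ x *_) (w≗w′ _ _))

⟪⟫-⊞ : ∀ A w w′ → ⟪ A ⟫ (w ⊞ w′) ≡ ⟪ A ⟫ w + ⟪ A ⟫ w′
⟪⟫-⊞ A w w′ = trans (∑-cong A (λ x → ℚP.*-distribˡ-+ (proj₁ x) _ _)) (∑-+ _ _ A)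

⟪⟫-⊟ : ∀ A w → ⟪ A ⟫ (⊟ w) ≡ - ⟪ A ⟫ w
⟪⟫-⊟ A w = trans (∑-cong A (λ x → sym (ℚP.neg-distribʳ-* (proj₁ x) _))) (∑-neg _ A)

⟪⟦⟧⟫ : ∀ κ w → ⟪ ⟦ κ ⟧ ⟫ w ≡ w κ 0
⟪⟦⟧⟫ κ w = trans (ℚP.+-identityʳ _) (ℚP.*-identityˡ _)

⟪It⟫ : ∀ A w → ⟪ It A ⟫ w ≡ ⟪ A ⟫ (It* w)
⟪It⟫ A w = trans (∑-concatMap _ _ A)
  (∑-cong A (λ x → trans (∑-map _ _ (combos (proj₂ (proj₂ x)))) (sym (*-distribˡ-∑ (proj₁ x) _ (combos (proj₂ (proj₂ x)))))))

⟪·⟫ : ∀ p A w → ⟪ p · A ⟫ w ≡ ⟪ A ⟫ (p ⋆ w)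
⟪·⟫ p A w = begin
  ⟪ p · A ⟫ w
    ≡⟨ ∑-concatMap _ _ p ⟩
  ∑ (λ ai → ∑ _ (map _ A)) p
    ≡⟨ ∑-cong p (λ { (a , i) → trans (∑-map _ _ A) (∑-cong A (λ { (q , j , κ) →
          trans (cong (_* w κ (i ℕ.+ j)) (ℚP.*-comm a q)) (ℚP.*-assoc q a _) })) }) ⟩
  ∑ (λ ai → ∑ (λ x → proj₁ x * (proj₁ ai * w (proj₂ (proj₂ x)) (proj₂ ai ℕ.+ proj₁ (proj₂ x)))) A) p
    ≡⟨ ∑-swap (λ ai x → proj₁ x * (proj₁ ai * w (proj₂ (proj₂ x)) (proj₂ ai ℕ.+ proj₁ (proj₂ x)))) p A ⟩
  ∑ (λ x → ∑ (λ ai → proj₁ x * (proj₁ ai * w (proj₂ (proj₂ x)) (proj₂ ai ℕ.+ proj₁ (proj₂ x)))) p) A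
    ≡⟨ ∑-cong A (λ x → *-distribˡ-∑ (proj₁ x) _ p) ⟨
  ⟪ A ⟫ (p ⋆ w) ∎
  where open ≡-Reasoning

indicator : Index → ℕ → Weight
indicator κ j λ′ i with ≡-dec ℕ._≟_ λ′ κ | i ℕ.≟ j
... | yes _ | yes _ = 1ℚ
... | _     | _     = 0ℚ

⟪indicator⟫≡coeff : ∀ A κ j → ⟪ A ⟫ (indicator κ j) ≡ coeff A κ j
⟪indicator⟫≡coeff []                  κ j = refl
⟪indicator⟫≡coeff ((q , i , λ′) ∷ A) κ j with ≡-dec ℕ._≟_ λ′ κ | i ℕ.≟ j
... | yes _ | yes _ = cong₂ _+_ (ℚP.*-identityʳ q) (⟪indicator⟫≡coeff A κ j)
... | yes _ | no _  = trans (cong₂ _+_ (ℚP.*-zeroʳ q) (⟪indicator⟫≡coeff A κ j)) (ℚP.+-identityˡ _)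
... | no _  | yes _ = trans (cong₂ _+_ (ℚP.*-zeroʳ q) (⟪indicator⟫≡coeff A κ j)) (ℚP.+-identityˡ _)
... | no _  | no _  = trans (cong₂ _+_ (ℚP.*-zeroʳ q) (⟪indicator⟫≡coeff A κ j)) (ℚP.+-identityˡ _)

≈-fromPairing : ∀ A B → (∀ w → ⟪ A ⟫ w ≡ ⟪ B ⟫ w) → A ≈ B
≈-fromPairing A B ⟪A⟫≗⟪B⟫ κ j =
  trans (sym (⟪indicator⟫≡coeff A κ j)) (trans (⟪A⟫≗⟪B⟫ (indicator κ j)) (⟪indicator⟫≡coeff B κ j))

-- Decompositions of k↑ and k→ into blocks (for g) and into combos (for I^t)

NonEmpty : {X : Set} → List X → Set
NonEmpty []      = ⊥
NonEmpty (_ ∷ _) = ⊤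

All-concatMap⁺ : ∀ {X Y : Set} {P : X → Set} {Q : Y → Set} {h : X → List Y} {xs} →
                 All P xs → (∀ {x} → P x → All Q (h x)) → All Q (concatMap h xs)
All-concatMap⁺ pxs P⇒Qh = AllP.concat⁺ (AllP.map⁺ (All.map P⇒Qh pxs))

upBlocks : List Index → List Index
upBlocks []          = []
upBlocks (b ∷ [])    = upI b ∷ []
upBlocks (b ∷ c ∷ D) = b ∷ upBlocks (c ∷ D)

extendLastBlock : ℕ → List Index → List Index
extendLastBlock a []          = []
extendLastBlock a (b ∷ [])    = (b ++ a ∷ []) ∷ []
extendLastBlock a (b ∷ c ∷ D) = b ∷ extendLastBlock a (c ∷ D)

appendBlock : ℕ → List Index → List Index
appendBlock a D = D ++ (a ∷ []) ∷ []

addToLast : ℕ → Index → Index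
addToLast a []           = []
addToLast a (z ∷ [])     = (z ℕ.+ a) ∷ []
addToLast a (z ∷ c ∷ cs) = z ∷ addToLast a (c ∷ cs)

upI-nonEmpty : ∀ y k → NonEmpty (upI (y ∷ k))
upI-nonEmpty y []      = tt
upI-nonEmpty y (z ∷ k) = tt

length-upI : ∀ b → length (upI b) ≡ length b
length-upI []          = refl
length-upI (x ∷ [])    = refl
length-upI (x ∷ y ∷ b) = cong suc (length-upI (y ∷ b))

sum-upI : ∀ b → NonEmpty b → sumℕ (upI b) ≡ suc (sumℕ b)
sum-upI (x ∷ [])    tt = refl
sum-upI (x ∷ y ∷ b) tt = trans (cong (x ℕ.+_) (sum-upI (y ∷ b) tt)) (ℕP.+-suc x (sumℕ (y ∷ b)))

length-snoc : ∀ {X : Set} (b : List X) a → length (b ++ a ∷ []) ≡ suc (length b)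
length-snoc b a = trans (length-++ b) (ℕP.+-comm (length b) 1)

sum-snoc : ∀ b a → sumℕ (b ++ a ∷ []) ≡ sumℕ b ℕ.+ a
sum-snoc b a = trans (sum-++ b (a ∷ [])) (cong (sumℕ b ℕ.+_) (ℕP.+-identityʳ a))

length-upBlocks : ∀ D → length (upBlocks D) ≡ length D
length-upBlocks []          = refl
length-upBlocks (b ∷ [])    = refl
length-upBlocks (b ∷ c ∷ D) = cong suc (length-upBlocks (c ∷ D))

length-extendLastBlock : ∀ a D → length (extendLastBlock a D) ≡ length D
length-extendLastBlock a []          = refl
length-extendLastBlock a (b ∷ [])    = refl
length-extendLastBlock a (b ∷ c ∷ D) = cong suc (length-extendLastBlock a (c ∷ D))

upBlocks-nonEmpty : ∀ c D → NonEmpty (upBlocks (c ∷ D))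
upBlocks-nonEmpty c []      = tt
upBlocks-nonEmpty c (d ∷ D) = tt

length-snoc∸1 : ∀ (b : Index) a → NonEmpty b → length (b ++ a ∷ []) ∸ 1 ≡ suc (length b ∸ 1)
length-snoc∸1 (x ∷ b) a tt = length-snoc b a

+0-assoc : ∀ p q → p + (q + 0ℚ) ≡ (p + q) + 0ℚ
+0-assoc = solve 2 (λ p q → p :+ (q :+ con 0ℚ) := (p :+ q) :+ con 0ℚ) refl

+0-interchange : ∀ p₁ p₂ q₁ q₂ → (p₁ + (p₂ + 0ℚ)) + (q₁ + (q₂ + 0ℚ)) ≡ (p₁ + q₁) + ((p₂ + q₂) + 0ℚ)
+0-interchange = solve 4 (λ p₁ p₂ q₁ q₂ →
  (p₁ :+ (p₂ :+ con 0ℚ)) :+ (q₁ :+ (q₂ :+ con 0ℚ)) := (p₁ :+ q₁) :+ ((p₂ :+ q₂) :+ con 0ℚ)) refl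

blocks-shape : ∀ k → All (λ D → All NonEmpty D × length D ≤ length k) (blocks k)
blocks-shape []       = ([] , z≤n) ∷ []
blocks-shape (x ∷ xs) = All-concatMap⁺ (blocks-shape xs)
  (λ { {[]}    _                → ((tt ∷ []) , s≤s z≤n) ∷ []
     ; {b ∷ D} (nb ∷ nD , D≤xs) → ((tt ∷ nb ∷ nD) , s≤s D≤xs) ∷ ((tt ∷ nD) , ℕP.m≤n⇒m≤1+n D≤xs) ∷ [] })

blocks-nonEmpty : ∀ y k → All NonEmpty (blocks (y ∷ k))
blocks-nonEmpty y k = All-concatMap⁺ (blocks-shape k) (λ { {[]} _ → tt ∷ [] ; {b ∷ D} _ → tt ∷ tt ∷ [] })

blocks-wellShaped : ∀ y k → All (λ D → NonEmpty D × All NonEmpty D) (blocks (y ∷ k))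
blocks-wellShaped y k = All.zip (blocks-nonEmpty y k , All.map proj₁ (blocks-shape (y ∷ k)))

∑-blocks-upI : ∀ y k (F : List Index → ℚ) → ∑ F (blocks (upI (y ∷ k))) ≡ ∑ (λ D → F (upBlocks D)) (blocks (y ∷ k))
∑-blocks-upI y []      F = refl
∑-blocks-upI x (y ∷ k) F =
  trans (∑-concatMap F _ (blocks (upI (y ∷ k))))
  (trans (∑-blocks-upI y k _)
  (trans (∑-cong-All (blocks-wellShaped y k)
            (λ { {[]} (() , _)
               ; {[] ∷ []} (tt , (() ∷ []))
               ; {(c ∷ b) ∷ []} _ → refl
               ; {b ∷ c ∷ E} _ → refl }))
  (sym (∑-concatMap (λ D → F (upBlocks D)) _ (blocks (y ∷ k))))))

∑-blocks-snoc : ∀ y k a (F : List Index → ℚ) →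
  ∑ F (blocks ((y ∷ k) ++ a ∷ [])) ≡ ∑ (λ D → F (appendBlock a D) + F (extendLastBlock a D)) (blocks (y ∷ k))
∑-blocks-snoc y []      a F = +0-assoc (F ((y ∷ []) ∷ (a ∷ []) ∷ [])) (F ((y ∷ a ∷ []) ∷ []))
∑-blocks-snoc x (y ∷ k) a F =
  trans (∑-concatMap F _ (blocks ((y ∷ k) ++ a ∷ [])))
  (trans (∑-blocks-snoc y k a _)
  (trans (∑-cong-All (blocks-nonEmpty y k)
            (λ { {[]} ()
               ; {b ∷ []} tt → +0-interchange (F ((x ∷ []) ∷ b ∷ (a ∷ []) ∷ [])) (F ((x ∷ b) ∷ (a ∷ []) ∷ []))
                                              (F ((x ∷ []) ∷ (b ++ a ∷ []) ∷ [])) (F ((x ∷ (b ++ a ∷ [])) ∷ []))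
               ; {b ∷ c ∷ E} tt → +0-interchange (F ((x ∷ []) ∷ b ∷ ((c ∷ E) ++ (a ∷ []) ∷ []))) (F ((x ∷ b) ∷ ((c ∷ E) ++ (a ∷ []) ∷ [])))
                                                 (F ((x ∷ []) ∷ b ∷ extendLastBlock a (c ∷ E))) (F ((x ∷ b) ∷ extendLastBlock a (c ∷ E))) }))
  (sym (∑-concatMap (λ D → F (appendBlock a D) + F (extendLastBlock a D)) _ (blocks (y ∷ k))))))

combos-nonEmpty : ∀ y k → All (λ c → NonEmpty (proj₂ c)) (combos (y ∷ k))
combos-nonEmpty y k = All-concatMap⁺ (All.universal (λ _ → tt) (combos k)) (λ { {p , []} _ → tt ∷ [] ; {p , z ∷ zs} _ → tt ∷ tt ∷ [] })

∑-combos-upI : ∀ y k (F : ℕ × Index → ℚ) → ∑ F (combos (upI (y ∷ k))) ≡ ∑ (λ c → F (proj₁ c , upI (proj₂ c))) (combos (y ∷ k))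
∑-combos-upI y []      F = refl
∑-combos-upI x (y ∷ k) F =
  trans (∑-concatMap F _ (combos (upI (y ∷ k))))
  (trans (∑-combos-upI y k _)
  (trans (∑-cong-All (combos-nonEmpty y k)
            (λ { {p , []} ()
               ; {p , z ∷ []} tt → cong (λ v → F (p , x ∷ suc z ∷ []) + (F (suc p , v ∷ []) + 0ℚ)) (ℕP.+-suc x z)
               ; {p , z ∷ c ∷ cs} tt → refl }))
  (sym (∑-concatMap (λ c → F (proj₁ c , upI (proj₂ c))) _ (combos (y ∷ k))))))

∑-combos-snoc : ∀ y k a (F : ℕ × Index → ℚ) → ∑ F (combos ((y ∷ k) ++ a ∷ []))
   ≡ ∑ (λ c → F (proj₁ c , proj₂ c ++ a ∷ []) + F (suc (proj₁ c) , addToLast a (proj₂ c))) (combos (y ∷ k))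
∑-combos-snoc y []      a F = +0-assoc (F (0 , y ∷ a ∷ [])) (F (1 , (y ℕ.+ a) ∷ []))
∑-combos-snoc x (y ∷ k) a F =
  trans (∑-concatMap F _ (combos ((y ∷ k) ++ a ∷ [])))
  (trans (∑-combos-snoc y k a _)
  (trans (∑-cong-All (combos-nonEmpty y k)
            (λ { {p , []} ()
               ; {p , z ∷ []} tt →
                   trans (+0-interchange (F (p , x ∷ z ∷ a ∷ [])) (F (suc p , (x ℕ.+ z) ∷ a ∷ []))
                                         (F (suc p , x ∷ (z ℕ.+ a) ∷ [])) (F (suc (suc p) , (x ℕ.+ (z ℕ.+ a)) ∷ [])))
                         (cong (λ v → (F (p , x ∷ z ∷ a ∷ []) + F (suc p , x ∷ (z ℕ.+ a) ∷ []))
                                      + ((F (suc p , (x ℕ.+ z) ∷ a ∷ []) + F (suc (suc p) , v ∷ [])) + 0ℚ))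
                               (sym (ℕP.+-assoc x z a)))
               ; {p , z ∷ c ∷ cs} tt →
                   +0-interchange (F (p , x ∷ z ∷ ((c ∷ cs) ++ a ∷ []))) (F (suc p , (x ℕ.+ z) ∷ ((c ∷ cs) ++ a ∷ [])))
                                  (F (suc p , x ∷ z ∷ addToLast a (c ∷ cs))) (F (suc (suc p) , (x ℕ.+ z) ∷ addToLast a (c ∷ cs))) }))
  (sym (∑-concatMap (λ c → F (proj₁ c , proj₂ c ++ a ∷ []) + F (suc (proj₁ c) , addToLast a (proj₂ c))) _ (combos (y ∷ k))))))

It*-upI : ∀ w a κ j → It* w (upI (a ∷ κ)) j ≡ It* (w ∘↑) (a ∷ κ) j
It*-upI w a κ j = ∑-combos-upI a κ (λ c → w (proj₂ c) (j ℕ.+ proj₁ c))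

addToLast-1 : ∀ κ → NonEmpty κ → addToLast 1 κ ≡ upI κ
addToLast-1 (z ∷ [])     tt = cong (_∷ []) (ℕP.+-comm z 1)
addToLast-1 (z ∷ c ∷ cs) tt = cong (z ∷_) (addToLast-1 (c ∷ cs) tt)

It*-snoc-1 : ∀ w a κ j → It* w ((a ∷ κ) ++ 1 ∷ []) j ≡ It* (w ∘→′) (a ∷ κ) j + It* (t ⋆ (w ∘↑)) (a ∷ κ) j
It*-snoc-1 w a κ j =
  trans (∑-combos-snoc a κ 1 (λ c → w (proj₂ c) (j ℕ.+ proj₁ c)))
  (trans (∑-+ (λ c → w (proj₂ c ++ 1 ∷ []) (j ℕ.+ proj₁ c)) (λ c → w (addToLast 1 (proj₂ c)) (j ℕ.+ suc (proj₁ c))) (combos (a ∷ κ)))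
  (cong (It* (w ∘→′) (a ∷ κ) j +_)
    (∑-cong-All (combos-nonEmpty a κ) (λ { {p , κ′} κ′≢[] →
      trans (cong₂ w (addToLast-1 κ′ κ′≢[]) (ℕP.+-suc j p)) (sym (▷-t (w (upI κ′)) (j ℕ.+ p))) }))))

It*-⋆t : ∀ w κ j → It* (t ⋆ w) κ j ≡ It* w κ (suc j)
It*-⋆t w κ j = ∑-cong (combos κ) (λ c → ▷-t (w (proj₂ c)) (j ℕ.+ proj₁ c))

It*-⋆oneMinusT : ∀ w κ j → It* (oneMinusT ⋆ w) κ j ≡ (oneMinusT ▷ It* w κ) j
It*-⋆oneMinusT w κ j = begin
  It* (oneMinusT ⋆ w) κ j
    ≡⟨ ∑-cong (combos κ) (λ c → ▷-oneMinusT (w (proj₂ c)) (j ℕ.+ proj₁ c)) ⟩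
  ∑ (λ c → w (proj₂ c) (j ℕ.+ proj₁ c) + - w (proj₂ c) (suc (j ℕ.+ proj₁ c))) (combos κ)
    ≡⟨ ∑-+ (λ c → w (proj₂ c) (j ℕ.+ proj₁ c)) (λ c → - w (proj₂ c) (suc (j ℕ.+ proj₁ c))) (combos κ) ⟩
  It* w κ j + ∑ (λ c → - w (proj₂ c) (suc (j ℕ.+ proj₁ c))) (combos κ)
    ≡⟨ cong (It* w κ j +_) (∑-neg (λ c → w (proj₂ c) (suc (j ℕ.+ proj₁ c))) (combos κ)) ⟩
  It* w κ j - It* w κ (suc j)
    ≡⟨ ▷-oneMinusT (It* w κ) j ⟨
  (oneMinusT ▷ It* w κ) j ∎
  where open ≡-Reasoning

blockPoly : ℕ → Index → ℕ → Poly
blockPoly first b e = f (length b ∸ 1) (ℤ.+ (sumℕ b ℕ.+ first)) e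

-- The pairing of Σ_{e₁+⋯+e_l = m} Π f(…, e_i) · (…, Σ b_i + e_i, …) with w, for D = (b₁, …, b_l);
-- first = 1 accounts for k′₁ = k₁ + 1 in the first block.
blockPairing : ℕ → List Index → ℕ → Weight → ℚ
blockPairing first []      m w = ifZero m (w [] 0)
blockPairing first (b ∷ D) m w =
  ∑< (suc m) (λ e → blockPairing 0 D (m ∸ e) (blockPoly first b e ⋆ (w ◁ (sumℕ b ℕ.+ e))))

blockTermPairing : ℕ → List Index → List ℕ → Weight → ℚ
blockTermPairing first D es w = (proj₁ (blockTerm first D es) ▷ w (proj₂ (blockTerm first D es))) 0

blockTermPairing-∷ : ∀ first b D e es w →
  blockTermPairing first (b ∷ D) (e ∷ es) w ≡ blockTermPairing 0 D es (blockPoly first b e ⋆ (w ◁ (sumℕ b ℕ.+ e)))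
blockTermPairing-∷ first b D e es w =
  trans (▷-polyMul (blockPoly first b e) (proj₁ (blockTerm 0 D es)) (w ((sumℕ b ℕ.+ e) ∷ proj₂ (blockTerm 0 D es))) 0)
        (▷-comm (blockPoly first b e) (proj₁ (blockTerm 0 D es)) (w ((sumℕ b ℕ.+ e) ∷ proj₂ (blockTerm 0 D es))) 0)

comps-suc : ∀ m l → comps m (suc l) ≡ concatMap (λ e → map (e ∷_) (comps (m ∸ e) l)) (upTo (suc m))
comps-suc zero    l = refl
comps-suc (suc m) l = refl

∑-comps≡blockPairing : ∀ first D m w → ∑ (λ es → blockTermPairing first D es w) (comps m (length D)) ≡ blockPairing first D m w
∑-comps≡blockPairing first []      zero    w = trans (ℚP.+-identityʳ _) (▷-one (w []) 0)
∑-comps≡blockPairing first []      (suc m) w = refl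
∑-comps≡blockPairing first (b ∷ D) m       w = begin
  ∑ (blockTermPairing′ (b ∷ D)) (comps m (suc (length D)))
    ≡⟨ cong (∑ (blockTermPairing′ (b ∷ D))) (comps-suc m (length D)) ⟩
  ∑ (blockTermPairing′ (b ∷ D)) (concatMap (λ e → map (e ∷_) (comps (m ∸ e) (length D))) (upTo (suc m)))
    ≡⟨ ∑-concatMap (blockTermPairing′ (b ∷ D)) (λ e → map (e ∷_) (comps (m ∸ e) (length D))) (upTo (suc m)) ⟩
  ∑ (λ e → ∑ (blockTermPairing′ (b ∷ D)) (map (e ∷_) (comps (m ∸ e) (length D)))) (upTo (suc m))
    ≡⟨ ∑-upTo _ (suc m) ⟩
  ∑< (suc m) (λ e → ∑ (blockTermPairing′ (b ∷ D)) (map (e ∷_) (comps (m ∸ e) (length D))))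
    ≡⟨ ∑<-cong (suc m) (λ e → trans (∑-map (blockTermPairing′ (b ∷ D)) (e ∷_) (comps (m ∸ e) (length D)))
         (trans (∑-cong (comps (m ∸ e) (length D)) (λ es → blockTermPairing-∷ first b D e es w))
                (∑-comps≡blockPairing 0 D (m ∸ e) _))) ⟩
  blockPairing first (b ∷ D) m w ∎
  where
  open ≡-Reasoning
  blockTermPairing′ : List Index → List ℕ → ℚ
  blockTermPairing′ D es = blockTermPairing first D es w

[-t[1-t]]^_ : ℕ → Poly
[-t[1-t]]^ n = polyPow minusTOneMinusT n

gPairing : ℕ → Index → Weight → ℚ
gPairing m k w = ∑ (λ D → blockPairing 1 D m ([-t[1-t]]^ (length k ∸ length D) ⋆ w)) (blocks k)

⟪g⟫ : ∀ m k w → ⟪ g m k ⟫ w ≡ gPairing m k w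
⟪g⟫ m k w =
  trans (∑-concatMap _ _ (blocks k))
  (∑-cong (blocks k) (λ D → trans (∑-concatMap _ _ (comps m (length D)))
     (trans (∑-cong (comps m (length D)) (λ es → ⟪term⟫ D es (length k ∸ length D)))
            (∑-comps≡blockPairing 1 D m ([-t[1-t]]^ (length k ∸ length D) ⋆ w)))))
  where
  ⟪term⟫ : ∀ D es n → ⟪ polyMul ([-t[1-t]]^ n) (proj₁ (blockTerm 1 D es)) · ⟦ proj₂ (blockTerm 1 D es) ⟧ ⟫ w
                     ≡ blockTermPairing 1 D es ([-t[1-t]]^ n ⋆ w)
  ⟪term⟫ D es n =
    trans (⟪·⟫ (polyMul ([-t[1-t]]^ n) p) ⟦ κ ⟧ w)
    (trans (⟪⟦⟧⟫ κ (polyMul ([-t[1-t]]^ n) p ⋆ w))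
    (trans (▷-polyMul ([-t[1-t]]^ n) p (w κ) 0) (▷-comm ([-t[1-t]]^ n) p (w κ) 0)))
    where
    p = proj₁ (blockTerm 1 D es)
    κ = proj₂ (blockTerm 1 D es)

gPairing-cong : ∀ m k {w w′ : Weight} → (∀ κ j → w κ j ≡ w′ κ j) → gPairing m k w ≡ gPairing m k w′
gPairing-cong m k {w} {w′} w≗w′ = trans (sym (⟪g⟫ m k w)) (trans (⟪⟫-cong (g m k) w≗w′) (⟪g⟫ m k w′))

gPairing-⊞ : ∀ m k w w′ → gPairing m k (w ⊞ w′) ≡ gPairing m k w + gPairing m k w′
gPairing-⊞ m k w w′ = trans (sym (⟪g⟫ m k (w ⊞ w′))) (trans (⟪⟫-⊞ (g m k) w w′) (cong₂ _+_ (⟪g⟫ m k w) (⟪g⟫ m k w′)))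

gPairing-⊟ : ∀ m k w → gPairing m k (⊟ w) ≡ - gPairing m k w
gPairing-⊟ m k w = trans (sym (⟪g⟫ m k (⊟ w))) (trans (⟪⟫-⊟ (g m k) w) (cong -_ (⟪g⟫ m k w)))

⟪G⟫ : ∀ m k w → ⟪ G m k ⟫ w ≡ gPairing m k (It* w)
⟪G⟫ m k w = trans (⟪It⟫ (g m k) w) (⟪g⟫ m k (It* w))

⟪Gprev⟫ : ∀ m k w → ⟪ Gprev m k ⟫ w ≡ atPred (λ n → gPairing n k (It* w)) m
⟪Gprev⟫ zero    k w = refl
⟪Gprev⟫ (suc m) k w = ⟪G⟫ m k w

blockPairing-cong : ∀ first D m {w w′ : Weight} → (∀ κ j → w κ j ≡ w′ κ j) → blockPairing first D m w ≡ blockPairing first D m w′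
blockPairing-cong first []      m w≗w′ = cong (ifZero m) (w≗w′ [] 0)
blockPairing-cong first (b ∷ D) m w≗w′ =
  ∑<-cong (suc m) (λ e → blockPairing-cong 0 D (m ∸ e) (λ κ j → ▷-cong (blockPoly first b e) (λ i → w≗w′ (sumℕ b ℕ.+ e ∷ κ) i) j))

blockPairing-cong-∷ : ∀ first D m → NonEmpty D → {w w′ : Weight} →
  (∀ a κ j → w (a ∷ κ) j ≡ w′ (a ∷ κ) j) → blockPairing first D m w ≡ blockPairing first D m w′
blockPairing-cong-∷ first (b ∷ D) m tt w≗w′ =
  ∑<-cong (suc m) (λ e → blockPairing-cong 0 D (m ∸ e) (λ κ j → ▷-cong (blockPoly first b e) (λ i → w≗w′ (sumℕ b ℕ.+ e) κ i) j))

gPairing-cong-∷ : ∀ m k → NonEmpty k → {w w′ : Weight} →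
  (∀ a κ j → w (a ∷ κ) j ≡ w′ (a ∷ κ) j) → gPairing m k w ≡ gPairing m k w′
gPairing-cong-∷ m (y ∷ k) tt w≗w′ = ∑-cong-All (blocks-nonEmpty y k)
  (λ {D} D≢[] → blockPairing-cong-∷ 1 D m D≢[] (λ a κ j → ▷-cong ([-t[1-t]]^ (length (y ∷ k) ∸ length D)) (λ i → w≗w′ a κ i) j))

-- Recursions for g_m(k↑) and g_m(k→)

+[1+n]≡+n+1 : ∀ n → ℤ.+ suc n ≡ ℤ.+ n ℤ.+ ℤ.+ 1
+[1+n]≡+n+1 n = cong ℤ.+_ (ℕP.+-comm 1 n)

singleBlock-↑ : ∀ i s first m (W : Weight) →
  (f i (ℤ.+ (suc s ℕ.+ first)) m ▷ W ((suc s ℕ.+ m) ∷ [])) 0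
  ≡ (f i (ℤ.+ (s ℕ.+ first)) m ▷ W (suc (s ℕ.+ m) ∷ [])) 0
    + atPred (λ n → (f i (ℤ.+ (suc s ℕ.+ first)) n ▷ (t ▷ W (suc (suc s ℕ.+ n) ∷ []))) 0) m
singleBlock-↑ i s first zero    W =
  trans (f[i,k,0]≐f[i,k′,0] i (ℤ.+ (suc s ℕ.+ first)) (ℤ.+ (s ℕ.+ first)) (W ((suc s ℕ.+ 0) ∷ [])) 0) (sym (ℚP.+-identityʳ _))
singleBlock-↑ i s first (suc n) W = begin
  (f i (ℤ.+ (suc s ℕ.+ first)) (suc n) ▷ X) 0
    ≡⟨ cong (λ k → (f i k (suc n) ▷ X) 0) (+[1+n]≡+n+1 (s ℕ.+ first)) ⟩
  (f i (K ℤ.+ ℤ.+ 1) (suc n) ▷ X) 0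
    ≡⟨ f-pascalᵏ i K n X 0 ⟩
  ((f i K (suc n) ++ polyMul (f i (K ℤ.+ ℤ.+ 1) n) t) ▷ X) 0
    ≡⟨ ▷-++ (f i K (suc n)) (polyMul (f i (K ℤ.+ ℤ.+ 1) n) t) X 0 ⟩
  (f i K (suc n) ▷ X) 0 + (polyMul (f i (K ℤ.+ ℤ.+ 1) n) t ▷ X) 0
    ≡⟨ cong ((f i K (suc n) ▷ X) 0 +_) (▷-polyMul (f i (K ℤ.+ ℤ.+ 1) n) t X 0) ⟩
  (f i K (suc n) ▷ X) 0 + (f i (K ℤ.+ ℤ.+ 1) n ▷ (t ▷ X)) 0
    ≡⟨ cong ((f i K (suc n) ▷ X) 0 +_) (cong₂ (λ k z → (f i k n ▷ (t ▷ W (z ∷ []))) 0)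
                                              (sym (+[1+n]≡+n+1 (s ℕ.+ first))) (ℕP.+-suc (suc s) n)) ⟩
  (f i K (suc n) ▷ X) 0 + (f i (ℤ.+ (suc s ℕ.+ first)) n ▷ (t ▷ W (suc (suc s ℕ.+ n) ∷ []))) 0 ∎
  where
  open ≡-Reasoning
  K = ℤ.+ (s ℕ.+ first)
  X = W ((suc s ℕ.+ suc n) ∷ [])

singleBlock-extend : ∀ i s first m (W : Weight) →
  (f (suc i) (ℤ.+ ((s ℕ.+ 1) ℕ.+ first)) m ▷ W (((s ℕ.+ 1) ℕ.+ m) ∷ [])) 0
  ≡ atPred (λ n → (f i (ℤ.+ (suc s ℕ.+ first)) n ▷ W (suc (suc s ℕ.+ n) ∷ [])) 0) m
    + atPred (λ n → (f (suc i) (ℤ.+ ((s ℕ.+ 2) ℕ.+ first)) n ▷ (oneMinusT ▷ W (((s ℕ.+ 2) ℕ.+ n) ∷ []))) 0) m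
singleBlock-extend i s first zero    W =
  trans (f[1+i,k,0]≐0 i (ℤ.+ ((s ℕ.+ 1) ℕ.+ first)) (W (((s ℕ.+ 1) ℕ.+ 0) ∷ [])) 0) (sym (ℚP.+-identityʳ 0ℚ))
singleBlock-extend i s first (suc n) W = begin
  (f (suc i) (ℤ.+ ((s ℕ.+ 1) ℕ.+ first)) (suc n) ▷ X) 0
    ≡⟨ cong (λ k → (f (suc i) (ℤ.+ k) (suc n) ▷ X) 0) s+1+f≡s+f+1 ⟩
  (f (suc i) (K ℤ.+ ℤ.+ 1) (suc n) ▷ X) 0
    ≡⟨ f-pascalⁱ i K n X 0 ⟩
  ((f i (K ℤ.+ ℤ.+ 1) n ++ polyMul (f (suc i) (K ℤ.+ ℤ.+ 2) n) oneMinusT) ▷ X) 0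
    ≡⟨ ▷-++ (f i (K ℤ.+ ℤ.+ 1) n) (polyMul (f (suc i) (K ℤ.+ ℤ.+ 2) n) oneMinusT) X 0 ⟩
  (f i (K ℤ.+ ℤ.+ 1) n ▷ X) 0 + (polyMul (f (suc i) (K ℤ.+ ℤ.+ 2) n) oneMinusT ▷ X) 0
    ≡⟨ cong₂ _+_ (cong₂ (λ k z → (f i k n ▷ W (z ∷ [])) 0) (sym (+[1+n]≡+n+1 (s ℕ.+ first))) 1+s+1+n≡2+s+n)
                 (trans (▷-polyMul (f (suc i) (K ℤ.+ ℤ.+ 2) n) oneMinusT X 0)
                        (cong₂ (λ k z → (f (suc i) (ℤ.+ k) n ▷ (oneMinusT ▷ W (z ∷ []))) 0) s+f+2≡s+2+f s+1+1+n≡s+2+n)) ⟩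
  (f i (ℤ.+ (suc s ℕ.+ first)) n ▷ W (suc (suc s ℕ.+ n) ∷ [])) 0
    + (f (suc i) (ℤ.+ ((s ℕ.+ 2) ℕ.+ first)) n ▷ (oneMinusT ▷ W (((s ℕ.+ 2) ℕ.+ n) ∷ []))) 0 ∎
  where
  open ≡-Reasoning
  K = ℤ.+ (s ℕ.+ first)
  X = W (((s ℕ.+ 1) ℕ.+ suc n) ∷ [])
  s+1+f≡s+f+1 : (s ℕ.+ 1) ℕ.+ first ≡ (s ℕ.+ first) ℕ.+ 1
  s+1+f≡s+f+1 = ℕS.solve 2 (λ s f → (s ℕS.:+ ℕS.con 1) ℕS.:+ f ℕS.:= (s ℕS.:+ f) ℕS.:+ ℕS.con 1) refl s first
  1+s+1+n≡2+s+n : (s ℕ.+ 1) ℕ.+ suc n ≡ suc (suc s ℕ.+ n)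
  1+s+1+n≡2+s+n = ℕS.solve 2 (λ s n →
    (s ℕS.:+ ℕS.con 1) ℕS.:+ (ℕS.con 1 ℕS.:+ n) ℕS.:= ℕS.con 1 ℕS.:+ (ℕS.con 1 ℕS.:+ s ℕS.:+ n)) refl s n
  s+f+2≡s+2+f : (s ℕ.+ first) ℕ.+ 2 ≡ (s ℕ.+ 2) ℕ.+ first
  s+f+2≡s+2+f = ℕS.solve 2 (λ s f → (s ℕS.:+ f) ℕS.:+ ℕS.con 2 ℕS.:= (s ℕS.:+ ℕS.con 2) ℕS.:+ f) refl s first
  s+1+1+n≡s+2+n : (s ℕ.+ 1) ℕ.+ suc n ≡ (s ℕ.+ 2) ℕ.+ n
  s+1+1+n≡s+2+n = ℕS.solve 2 (λ s n → (s ℕS.:+ ℕS.con 1) ℕS.:+ (ℕS.con 1 ℕS.:+ n) ℕS.:= (s ℕS.:+ ℕS.con 2) ℕS.:+ n) refl s n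

blockPairing-[b] : ∀ first b m w → blockPairing first (b ∷ []) m w ≡ (blockPoly first b m ▷ w ((sumℕ b ℕ.+ m) ∷ [])) 0
blockPairing-[b] first b m w = ∑<-ifZero m (λ e → (blockPoly first b e ▷ w ((sumℕ b ℕ.+ e) ∷ [])) 0)

blockPairing-[upI-b] : ∀ first b → NonEmpty b → ∀ m (W : Index → Seq) →
  blockPairing first (upI b ∷ []) m (λ κ → W (upI κ))
  ≡ (f (length b ∸ 1) (ℤ.+ (suc (sumℕ b) ℕ.+ first)) m ▷ W (suc (suc (sumℕ b) ℕ.+ m) ∷ [])) 0
blockPairing-[upI-b] first b b≢[] m W =
  trans (blockPairing-[b] first (upI b) m (λ κ → W (upI κ)))
        (cong₂ (λ L S → (f (L ∸ 1) (ℤ.+ (S ℕ.+ first)) m ▷ W (suc (S ℕ.+ m) ∷ [])) 0) (length-upI b) (sum-upI b b≢[]))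

blockPairing-upBlocks : ∀ first b D → All NonEmpty (b ∷ D) → ∀ m w →
  blockPairing first (upBlocks (b ∷ D)) m w
  ≡ blockPairing first (b ∷ D) m (w ∘↑) + atPred (λ n → blockPairing first (upBlocks (b ∷ D)) n (t ⋆ (w ∘↑))) m
blockPairing-upBlocks first b [] (b≢[] ∷ []) m w = begin
  blockPairing first (upI b ∷ []) m w
    ≡⟨ blockPairing-[b] first (upI b) m w ⟩
  (blockPoly first (upI b) m ▷ w ((sumℕ (upI b) ℕ.+ m) ∷ [])) 0
    ≡⟨ cong₂ (λ L S → (f (L ∸ 1) (ℤ.+ (S ℕ.+ first)) m ▷ w ((S ℕ.+ m) ∷ [])) 0) (length-upI b) (sum-upI b b≢[]) ⟩
  (f i (ℤ.+ (suc (sumℕ b) ℕ.+ first)) m ▷ w ((suc (sumℕ b) ℕ.+ m) ∷ [])) 0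
    ≡⟨ singleBlock-↑ i (sumℕ b) first m w ⟩
  (f i (ℤ.+ (sumℕ b ℕ.+ first)) m ▷ w (suc (sumℕ b ℕ.+ m) ∷ [])) 0
    + atPred (λ n → (f i (ℤ.+ (suc (sumℕ b) ℕ.+ first)) n ▷ (t ▷ w (suc (suc (sumℕ b) ℕ.+ n) ∷ []))) 0) m
    ≡⟨ cong₂ _+_ (blockPairing-[b] first b m (w ∘↑))
                 (atPred-cong m (λ n → blockPairing-[upI-b] first b b≢[] n (λ κ → t ▷ w κ))) ⟨
  blockPairing first (b ∷ []) m (w ∘↑) + atPred (λ n → blockPairing first (upI b ∷ []) n (t ⋆ (w ∘↑))) m ∎
  where
  open ≡-Reasoning
  i = length b ∸ 1
blockPairing-upBlocks first b (c ∷ D) (b≢[] ∷ cD≢[]) m w = begin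
  ∑< (suc m) (λ e → blockPairing 0 (upBlocks (c ∷ D)) (m ∸ e) (W e))
    ≡⟨ ∑<-cong (suc m) (λ e → blockPairing-upBlocks 0 c D cD≢[] (m ∸ e) (W e)) ⟩
  ∑< (suc m) (λ e → A e + B e)
    ≡⟨ ∑<-+ (suc m) A B ⟩
  ∑< (suc m) A + ∑< (suc m) B
    ≡⟨ cong (∑< (suc m) A +_) (∑<-atPred m (λ e n → blockPairing 0 (upBlocks (c ∷ D)) n (t ⋆ (W e ∘↑)))) ⟩
  ∑< (suc m) A + atPred (λ n → ∑< (suc n) (λ e → blockPairing 0 (upBlocks (c ∷ D)) (n ∸ e) (t ⋆ (W e ∘↑)))) m
    ≡⟨ cong₂ _+_ (∑<-cong (suc m) (λ e → blockPairing-cong-∷ 0 (c ∷ D) (m ∸ e) tt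
                                 {W e ∘↑} {blockPoly first b e ⋆ ((w ∘↑) ◁ (sumℕ b ℕ.+ e))} (λ a κ j → refl)))
                 (atPred-cong m (λ n → ∑<-cong (suc n) (λ e →
                    blockPairing-cong-∷ 0 (upBlocks (c ∷ D)) (n ∸ e) (upBlocks-nonEmpty c D)
                      (λ a κ j → ▷-comm t (blockPoly first b e) (w ((sumℕ b ℕ.+ e) ∷ upI (a ∷ κ))) j)))) ⟩
  blockPairing first (b ∷ c ∷ D) m (w ∘↑) + atPred (λ n → blockPairing first (upBlocks (b ∷ c ∷ D)) n (t ⋆ (w ∘↑))) m ∎
  where
  open ≡-Reasoning
  W : ℕ → Weight
  W e = blockPoly first b e ⋆ (w ◁ (sumℕ b ℕ.+ e))
  A B : ℕ → ℚ
  A e = blockPairing 0 (c ∷ D) (m ∸ e) (W e ∘↑)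
  B e = atPred (λ n → blockPairing 0 (upBlocks (c ∷ D)) n (t ⋆ (W e ∘↑))) (m ∸ e)

blockPairing-[b,1] : ∀ first b m w →
  blockPairing first (b ∷ (1 ∷ []) ∷ []) m w
  ≡ blockPairing first (b ∷ []) m (w ∘→′) + atPred (λ n → blockPairing first (b ∷ (2 ∷ []) ∷ []) n (oneMinusT ⋆ w)) m
blockPairing-[b,1] first b zero w = begin
  0ℚ + blockPairing 0 ((1 ∷ []) ∷ []) 0 (W 0)
    ≡⟨ ℚP.+-identityˡ _ ⟩
  blockPairing 0 ((1 ∷ []) ∷ []) 0 (W 0)
    ≡⟨ trans (blockPairing-[b] 0 (1 ∷ []) 0 (W 0)) (trans (f[0,k,0]≐1 (ℤ.+ 1) (W 0 (1 ∷ [])) 0) (▷-one (W 0 (1 ∷ [])) 0)) ⟩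
  W 0 (1 ∷ []) 0
    ≡⟨ blockPairing-[b] first b 0 (w ∘→′) ⟨
  blockPairing first (b ∷ []) 0 (w ∘→′)
    ≡⟨ ℚP.+-identityʳ _ ⟨
  blockPairing first (b ∷ []) 0 (w ∘→′) + 0ℚ ∎
  where
  open ≡-Reasoning
  W : ℕ → Weight
  W e = blockPoly first b e ⋆ (w ◁ (sumℕ b ℕ.+ e))
blockPairing-[b,1] first b (suc n) w = begin
  ∑< (suc m) (λ e → blockPairing 0 ((1 ∷ []) ∷ []) (m ∸ e) (W e))
    ≡⟨ ∑<-cong (suc m) (λ e → blockPairing-[b] 0 (1 ∷ []) (m ∸ e) (W e)) ⟩
  ∑< m T₁ + T₁ m
    ≡⟨ cong₂ _+_ (∑<-cong-< m T₁≡T₂) lastTerm ⟩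
  ∑< m T₂ + R m
    ≡⟨ ℚP.+-comm (∑< m T₂) (R m) ⟩
  R m + ∑< m T₂
    ≡⟨ cong₂ _+_ (blockPairing-[b] first b m (w ∘→′))
                 (∑<-cong m (λ e → blockPairing-[b] 0 (2 ∷ []) (n ∸ e) (blockPoly first b e ⋆ ((oneMinusT ⋆ w) ◁ (sumℕ b ℕ.+ e))))) ⟨
  blockPairing first (b ∷ []) m (w ∘→′) + atPred (λ n → blockPairing first (appendBlock 2 (b ∷ [])) n (oneMinusT ⋆ w)) m ∎
  where
  open ≡-Reasoning
  m = suc n
  W : ℕ → Weight
  W e = blockPoly first b e ⋆ (w ◁ (sumℕ b ℕ.+ e))
  R T₁ T₂ : ℕ → ℚ
  R e  = (blockPoly first b e ▷ w ((sumℕ b ℕ.+ e) ∷ 1 ∷ [])) 0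
  T₁ e = (f 0 (ℤ.+ 1) (m ∸ e) ▷ W e (suc (m ∸ e) ∷ [])) 0
  T₂ e = (f 0 (ℤ.+ 2) (n ∸ e) ▷ (blockPoly first b e ▷ (oneMinusT ▷ w ((sumℕ b ℕ.+ e) ∷ suc (suc (n ∸ e)) ∷ [])))) 0
  lastTerm : T₁ m ≡ R m
  lastTerm = trans (cong (λ r → (f 0 (ℤ.+ 1) r ▷ W m (suc r ∷ [])) 0) (ℕP.n∸n≡0 n))
                   (trans (f[0,k,0]≐1 (ℤ.+ 1) (W m (1 ∷ [])) 0) (▷-one (W m (1 ∷ [])) 0))
  T₁≡T₂ : ∀ e → e < m → T₁ e ≡ T₂ e
  T₁≡T₂ e e<m = begin
    (f 0 (ℤ.+ 1) (m ∸ e) ▷ W e (suc (m ∸ e) ∷ [])) 0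
      ≡⟨ cong (λ r → (f 0 (ℤ.+ 1) r ▷ W e (suc r ∷ [])) 0) (ℕP.+-∸-assoc 1 (ℕP.≤-pred e<m)) ⟩
    (f 0 (ℤ.+ 1) (suc r) ▷ X) 0
      ≡⟨ f[0,1,1+e]≐[1-t]f[0,2,e] r X 0 ⟩
    (polyMul oneMinusT (f 0 (ℤ.+ 2) r) ▷ X) 0
      ≡⟨ ▷-polyMul oneMinusT (f 0 (ℤ.+ 2) r) X 0 ⟩
    (oneMinusT ▷ (f 0 (ℤ.+ 2) r ▷ X)) 0
      ≡⟨ ▷-comm oneMinusT (f 0 (ℤ.+ 2) r) X 0 ⟩
    (f 0 (ℤ.+ 2) r ▷ (oneMinusT ▷ X)) 0
      ≡⟨ ▷-cong (f 0 (ℤ.+ 2) r) (▷-comm oneMinusT (blockPoly first b e) (w ((sumℕ b ℕ.+ e) ∷ suc (suc r) ∷ []))) 0 ⟩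
    T₂ e ∎
    where
    r = n ∸ e
    X = W e (suc (suc r) ∷ [])

blockPairing-appendBlock : ∀ first b D m w →
  blockPairing first (appendBlock 1 (b ∷ D)) m w
  ≡ blockPairing first (b ∷ D) m (w ∘→′) + atPred (λ n → blockPairing first (appendBlock 2 (b ∷ D)) n (oneMinusT ⋆ w)) m
blockPairing-appendBlock first b []      m w = blockPairing-[b,1] first b m w
blockPairing-appendBlock first b (c ∷ D) m w = begin
  ∑< (suc m) (λ e → blockPairing 0 (appendBlock 1 (c ∷ D)) (m ∸ e) (W e))
    ≡⟨ ∑<-cong (suc m) (λ e → blockPairing-appendBlock 0 c D (m ∸ e) (W e)) ⟩
  ∑< (suc m) (λ e → A e + B e)
    ≡⟨ ∑<-+ (suc m) A B ⟩
  ∑< (suc m) A + ∑< (suc m) B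
    ≡⟨ cong (∑< (suc m) A +_) (∑<-atPred m (λ e n → blockPairing 0 (appendBlock 2 (c ∷ D)) n (oneMinusT ⋆ W e))) ⟩
  ∑< (suc m) A + atPred (λ n → ∑< (suc n) (λ e → blockPairing 0 (appendBlock 2 (c ∷ D)) (n ∸ e) (oneMinusT ⋆ W e))) m
    ≡⟨ cong (∑< (suc m) A +_) (atPred-cong m (λ n → ∑<-cong (suc n) (λ e → blockPairing-cong 0 (appendBlock 2 (c ∷ D)) (n ∸ e)
          (λ κ j → ▷-comm oneMinusT (blockPoly first b e) (w ((sumℕ b ℕ.+ e) ∷ κ)) j)))) ⟩
  blockPairing first (b ∷ c ∷ D) m (w ∘→′) + atPred (λ n → blockPairing first (appendBlock 2 (b ∷ c ∷ D)) n (oneMinusT ⋆ w)) m ∎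
  where
  open ≡-Reasoning
  W : ℕ → Weight
  W e = blockPoly first b e ⋆ (w ◁ (sumℕ b ℕ.+ e))
  A B : ℕ → ℚ
  A e = blockPairing 0 (c ∷ D) (m ∸ e) (W e ∘→′)
  B e = atPred (λ n → blockPairing 0 (appendBlock 2 (c ∷ D)) n (oneMinusT ⋆ W e)) (m ∸ e)

blockPairing-[b++a] : ∀ first b a → NonEmpty b → ∀ m (W : Index → Seq) →
  blockPairing first ((b ++ a ∷ []) ∷ []) m W
  ≡ (f (suc (length b ∸ 1)) (ℤ.+ ((sumℕ b ℕ.+ a) ℕ.+ first)) m ▷ W (((sumℕ b ℕ.+ a) ℕ.+ m) ∷ [])) 0
blockPairing-[b++a] first b a b≢[] m W =
  trans (blockPairing-[b] first (b ++ a ∷ []) m W)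
        (cong₂ (λ L S → (f L (ℤ.+ (S ℕ.+ first)) m ▷ W ((S ℕ.+ m) ∷ [])) 0) (length-snoc∸1 b a b≢[]) (sum-snoc b a))

blockPairing-extendLastBlock : ∀ first b D → All NonEmpty (b ∷ D) → ∀ m w →
  blockPairing first (extendLastBlock 1 (b ∷ D)) m w
  ≡ atPred (λ n → blockPairing first (upBlocks (b ∷ D)) n (w ∘↑)) m
    + atPred (λ n → blockPairing first (extendLastBlock 2 (b ∷ D)) n (oneMinusT ⋆ w)) m
blockPairing-extendLastBlock first b [] (b≢[] ∷ []) m w = begin
  blockPairing first ((b ++ 1 ∷ []) ∷ []) m w
    ≡⟨ blockPairing-[b++a] first b 1 b≢[] m w ⟩
  (f (suc i) (ℤ.+ ((sumℕ b ℕ.+ 1) ℕ.+ first)) m ▷ w (((sumℕ b ℕ.+ 1) ℕ.+ m) ∷ [])) 0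
    ≡⟨ singleBlock-extend i (sumℕ b) first m w ⟩
  atPred (λ n → (f i (ℤ.+ (suc (sumℕ b) ℕ.+ first)) n ▷ w (suc (suc (sumℕ b) ℕ.+ n) ∷ [])) 0) m
    + atPred (λ n → (f (suc i) (ℤ.+ ((sumℕ b ℕ.+ 2) ℕ.+ first)) n ▷ (oneMinusT ▷ w (((sumℕ b ℕ.+ 2) ℕ.+ n) ∷ []))) 0) m
    ≡⟨ cong₂ _+_ (atPred-cong m (λ n → blockPairing-[upI-b] first b b≢[] n w))
                 (atPred-cong m (λ n → blockPairing-[b++a] first b 2 b≢[] n (λ κ → oneMinusT ▷ w κ))) ⟨
  atPred (λ n → blockPairing first (upI b ∷ []) n (w ∘↑)) m
    + atPred (λ n → blockPairing first ((b ++ 2 ∷ []) ∷ []) n (oneMinusT ⋆ w)) m ∎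
  where
  open ≡-Reasoning
  i = length b ∸ 1
blockPairing-extendLastBlock first b (c ∷ D) (b≢[] ∷ cD≢[]) m w = begin
  ∑< (suc m) (λ e → blockPairing 0 (extendLastBlock 1 (c ∷ D)) (m ∸ e) (W e))
    ≡⟨ ∑<-cong (suc m) (λ e → blockPairing-extendLastBlock 0 c D cD≢[] (m ∸ e) (W e)) ⟩
  ∑< (suc m) (λ e → A e + B e)
    ≡⟨ ∑<-+ (suc m) A B ⟩
  ∑< (suc m) A + ∑< (suc m) B
    ≡⟨ cong₂ _+_ (∑<-atPred m (λ e n → blockPairing 0 (upBlocks (c ∷ D)) n (W e ∘↑)))
                 (∑<-atPred m (λ e n → blockPairing 0 (extendLastBlock 2 (c ∷ D)) n (oneMinusT ⋆ W e))) ⟩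
  atPred (λ n → ∑< (suc n) (λ e → blockPairing 0 (upBlocks (c ∷ D)) (n ∸ e) (W e ∘↑))) m
    + atPred (λ n → ∑< (suc n) (λ e → blockPairing 0 (extendLastBlock 2 (c ∷ D)) (n ∸ e) (oneMinusT ⋆ W e))) m
    ≡⟨ cong₂ _+_
         (atPred-cong m (λ n → ∑<-cong (suc n) (λ e → blockPairing-cong-∷ 0 (upBlocks (c ∷ D)) (n ∸ e) (upBlocks-nonEmpty c D)
            {W e ∘↑} {blockPoly first b e ⋆ ((w ∘↑) ◁ (sumℕ b ℕ.+ e))} (λ a κ j → refl))))
         (atPred-cong m (λ n → ∑<-cong (suc n) (λ e → blockPairing-cong 0 (extendLastBlock 2 (c ∷ D)) (n ∸ e)
            (λ κ j → ▷-comm oneMinusT (blockPoly first b e) (w ((sumℕ b ℕ.+ e) ∷ κ)) j)))) ⟩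
  atPred (λ n → blockPairing first (upBlocks (b ∷ c ∷ D)) n (w ∘↑)) m
    + atPred (λ n → blockPairing first (extendLastBlock 2 (b ∷ c ∷ D)) n (oneMinusT ⋆ w)) m ∎
  where
  open ≡-Reasoning
  W : ℕ → Weight
  W e = blockPoly first b e ⋆ (w ◁ (sumℕ b ℕ.+ e))
  A B : ℕ → ℚ
  A e = atPred (λ n → blockPairing 0 (upBlocks (c ∷ D)) n (W e ∘↑)) (m ∸ e)
  B e = atPred (λ n → blockPairing 0 (extendLastBlock 2 (c ∷ D)) n (oneMinusT ⋆ W e)) (m ∸ e)

gPairing-upI-blocks : ∀ y k m w →
  gPairing m (upI (y ∷ k)) w ≡ ∑ (λ D → blockPairing 1 (upBlocks D) m ([-t[1-t]]^ (length (y ∷ k) ∸ length D) ⋆ w)) (blocks (y ∷ k))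
gPairing-upI-blocks y k m w =
  trans (∑-blocks-upI y k (λ D → blockPairing 1 D m ([-t[1-t]]^ (length (upI (y ∷ k)) ∸ length D) ⋆ w)))
        (∑-cong (blocks (y ∷ k)) (λ D → cong₂ (λ L L′ → blockPairing 1 (upBlocks D) m ([-t[1-t]]^ (L ∸ L′) ⋆ w))
                                               (length-upI (y ∷ k)) (length-upBlocks D)))

gPairing-snoc-blocks : ∀ y k a m w → gPairing m ((y ∷ k) ++ a ∷ []) w ≡
  ∑ (λ D → blockPairing 1 (appendBlock a D) m ([-t[1-t]]^ (length (y ∷ k) ∸ length D) ⋆ w)
         + blockPairing 1 (extendLastBlock a D) m ([-t[1-t]]^ (suc (length (y ∷ k) ∸ length D)) ⋆ w)) (blocks (y ∷ k))
gPairing-snoc-blocks y k a m w =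
  trans (∑-blocks-snoc y k a (λ D → blockPairing 1 D m ([-t[1-t]]^ (length ((y ∷ k) ++ a ∷ []) ∸ length D) ⋆ w)))
  (∑-cong-All (blocks-shape (y ∷ k)) (λ {D} (_ , D≤k) → cong₂ _+_
     (cong (λ L → blockPairing 1 (appendBlock a D) m ([-t[1-t]]^ L ⋆ w)) (cong₂ _∸_ (length-snoc (y ∷ k) a) (length-snoc D (a ∷ []))))
     (cong (λ L → blockPairing 1 (extendLastBlock a D) m ([-t[1-t]]^ L ⋆ w))
           (trans (cong₂ _∸_ (length-snoc (y ∷ k) a) (length-extendLastBlock a D)) (ℕP.+-∸-assoc 1 D≤k)))))

gPairing-upI : ∀ y k m w →
  gPairing m (upI (y ∷ k)) w ≡ gPairing m (y ∷ k) (w ∘↑) + atPred (λ n → gPairing n (upI (y ∷ k)) (t ⋆ (w ∘↑))) m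
gPairing-upI y k m w = begin
  gPairing m (upI (y ∷ k)) w
    ≡⟨ gPairing-upI-blocks y k m w ⟩
  ∑ (λ D → blockPairing 1 (upBlocks D) m (μ D ⋆ w)) (blocks (y ∷ k))
    ≡⟨ ∑-cong-All (blocks-wellShaped y k) (λ { {[]} (() , _) ; {b ∷ D} (tt , bD≢[]) → blockPairing-upBlocks 1 b D bD≢[] m (μ (b ∷ D) ⋆ w) }) ⟩
  ∑ (λ D → blockPairing 1 D m ((μ D ⋆ w) ∘↑) + atPred (λ n → blockPairing 1 (upBlocks D) n (t ⋆ ((μ D ⋆ w) ∘↑))) m) (blocks (y ∷ k))
    ≡⟨ ∑-+ _ _ (blocks (y ∷ k)) ⟩
  gPairing m (y ∷ k) (w ∘↑) + ∑ (λ D → atPred (λ n → blockPairing 1 (upBlocks D) n (t ⋆ ((μ D ⋆ w) ∘↑))) m) (blocks (y ∷ k))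
    ≡⟨ cong (gPairing m (y ∷ k) (w ∘↑) +_) (∑-atPred (λ D n → blockPairing 1 (upBlocks D) n (t ⋆ ((μ D ⋆ w) ∘↑))) (blocks (y ∷ k)) m) ⟩
  gPairing m (y ∷ k) (w ∘↑) + atPred (λ n → ∑ (λ D → blockPairing 1 (upBlocks D) n (t ⋆ ((μ D ⋆ w) ∘↑))) (blocks (y ∷ k))) m
    ≡⟨ cong (gPairing m (y ∷ k) (w ∘↑) +_) (atPred-cong m (λ n → trans
         (∑-cong (blocks (y ∷ k)) (λ D → blockPairing-cong 1 (upBlocks D) n (λ κ j → ▷-comm t (μ D) (w (upI κ)) j)))
         (sym (gPairing-upI-blocks y k n (t ⋆ (w ∘↑)))))) ⟩
  gPairing m (y ∷ k) (w ∘↑) + atPred (λ n → gPairing n (upI (y ∷ k)) (t ⋆ (w ∘↑))) m ∎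
  where
  open ≡-Reasoning
  μ : List Index → Poly
  μ D = [-t[1-t]]^ (length (y ∷ k) ∸ length D)

blockPairing-snoc-1 : ∀ N D → NonEmpty D → All NonEmpty D → ∀ m w →
  blockPairing 1 (appendBlock 1 D) m ([-t[1-t]]^ N ⋆ w) + blockPairing 1 (extendLastBlock 1 D) m ([-t[1-t]]^ (suc N) ⋆ w)
  ≡ (blockPairing 1 D m ([-t[1-t]]^ N ⋆ (w ∘→′))
      + atPred (λ n → blockPairing 1 (appendBlock 2 D) n ([-t[1-t]]^ N ⋆ (oneMinusT ⋆ w))
                    + blockPairing 1 (extendLastBlock 2 D) n ([-t[1-t]]^ (suc N) ⋆ (oneMinusT ⋆ w))) m)
    + atPred (λ n → blockPairing 1 (upBlocks D) n ([-t[1-t]]^ N ⋆ (minusTOneMinusT ⋆ (w ∘↑)))) m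
blockPairing-snoc-1 N (b ∷ D) tt bD≢[] m w = begin
  blockPairing 1 (appendBlock 1 (b ∷ D)) m (μ ⋆ w) + blockPairing 1 (extendLastBlock 1 (b ∷ D)) m (polyMul minusTOneMinusT μ ⋆ w)
    ≡⟨ cong₂ _+_ (blockPairing-appendBlock 1 b D m (μ ⋆ w)) (blockPairing-extendLastBlock 1 b D bD≢[] m (polyMul minusTOneMinusT μ ⋆ w)) ⟩
  (X + atPred (λ n → blockPairing 1 (appendBlock 2 (b ∷ D)) n (oneMinusT ⋆ (μ ⋆ w))) m)
    + (atPred (λ n → blockPairing 1 (upBlocks (b ∷ D)) n ((polyMul minusTOneMinusT μ ⋆ w) ∘↑)) m
       + atPred (λ n → blockPairing 1 (extendLastBlock 2 (b ∷ D)) n (oneMinusT ⋆ (polyMul minusTOneMinusT μ ⋆ w))) m)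
    ≡⟨ cong₂ _+_ (cong (X +_) (atPred-cong m (λ n → commuteAppend n)))
                 (cong₂ _+_ (atPred-cong m (λ n → commuteUp n)) (atPred-cong m (λ n → commuteExtend n))) ⟩
  (X + P₁) + (Q + P₂)
    ≡⟨ solve 4 (λ X P₁ Q P₂ → (X :+ P₁) :+ (Q :+ P₂) := (X :+ (P₁ :+ P₂)) :+ Q) refl X P₁ Q P₂ ⟩
  (X + (P₁ + P₂)) + Q
    ≡⟨ cong (λ z → (X + z) + Q) (atPred-+ (λ n → blockPairing 1 (appendBlock 2 (b ∷ D)) n (μ ⋆ (oneMinusT ⋆ w)))
                                           (λ n → blockPairing 1 (extendLastBlock 2 (b ∷ D)) n (polyMul minusTOneMinusT μ ⋆ (oneMinusT ⋆ w))) m) ⟨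
  (X + atPred (λ n → blockPairing 1 (appendBlock 2 (b ∷ D)) n (μ ⋆ (oneMinusT ⋆ w))
                   + blockPairing 1 (extendLastBlock 2 (b ∷ D)) n (polyMul minusTOneMinusT μ ⋆ (oneMinusT ⋆ w))) m) + Q ∎
  where
  open ≡-Reasoning
  μ = [-t[1-t]]^ N
  X = blockPairing 1 (b ∷ D) m (μ ⋆ (w ∘→′))
  P₁ = atPred (λ n → blockPairing 1 (appendBlock 2 (b ∷ D)) n (μ ⋆ (oneMinusT ⋆ w))) m
  P₂ = atPred (λ n → blockPairing 1 (extendLastBlock 2 (b ∷ D)) n (polyMul minusTOneMinusT μ ⋆ (oneMinusT ⋆ w))) m
  Q = atPred (λ n → blockPairing 1 (upBlocks (b ∷ D)) n (μ ⋆ (minusTOneMinusT ⋆ (w ∘↑)))) m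
  commuteAppend : ∀ n → blockPairing 1 (appendBlock 2 (b ∷ D)) n (oneMinusT ⋆ (μ ⋆ w))
                      ≡ blockPairing 1 (appendBlock 2 (b ∷ D)) n (μ ⋆ (oneMinusT ⋆ w))
  commuteAppend n = blockPairing-cong 1 (appendBlock 2 (b ∷ D)) n (λ κ j → ▷-comm oneMinusT μ (w κ) j)
  commuteUp : ∀ n → blockPairing 1 (upBlocks (b ∷ D)) n ((polyMul minusTOneMinusT μ ⋆ w) ∘↑)
                  ≡ blockPairing 1 (upBlocks (b ∷ D)) n (μ ⋆ (minusTOneMinusT ⋆ (w ∘↑)))
  commuteUp n = blockPairing-cong 1 (upBlocks (b ∷ D)) n
    (λ κ j → trans (▷-polyMul minusTOneMinusT μ (w (upI κ)) j) (▷-comm minusTOneMinusT μ (w (upI κ)) j))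
  commuteExtend : ∀ n → blockPairing 1 (extendLastBlock 2 (b ∷ D)) n (oneMinusT ⋆ (polyMul minusTOneMinusT μ ⋆ w))
                      ≡ blockPairing 1 (extendLastBlock 2 (b ∷ D)) n (polyMul minusTOneMinusT μ ⋆ (oneMinusT ⋆ w))
  commuteExtend n = blockPairing-cong 1 (extendLastBlock 2 (b ∷ D)) n (λ κ j → ▷-comm oneMinusT (polyMul minusTOneMinusT μ) (w κ) j)

gPairing-snoc-1 : ∀ y k m w → gPairing m ((y ∷ k) ++ 1 ∷ []) w ≡
  gPairing m (y ∷ k) (w ∘→′) + atPred (λ n → gPairing n ((y ∷ k) ++ 2 ∷ []) (oneMinusT ⋆ w)) m
    + atPred (λ n → gPairing n (upI (y ∷ k)) (minusTOneMinusT ⋆ (w ∘↑))) m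
gPairing-snoc-1 y k m w = begin
  gPairing m ((y ∷ k) ++ 1 ∷ []) w
    ≡⟨ gPairing-snoc-blocks y k 1 m w ⟩
  ∑ (λ D → blockPairing 1 (appendBlock 1 D) m (μ D ⋆ w) + blockPairing 1 (extendLastBlock 1 D) m ([-t[1-t]]^ (suc (N D)) ⋆ w)) (blocks (y ∷ k))
    ≡⟨ ∑-cong-All (blocks-wellShaped y k) (λ {D} (D≢[] , D≢[]s) → blockPairing-snoc-1 (N D) D D≢[] D≢[]s m w) ⟩
  ∑ (λ D → X D + atPred (P D) m + atPred (Q D) m) (blocks (y ∷ k))
    ≡⟨ trans (∑-+ _ _ (blocks (y ∷ k))) (cong (_+ ∑ (λ D → atPred (Q D) m) (blocks (y ∷ k))) (∑-+ _ _ (blocks (y ∷ k)))) ⟩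
  ∑ X (blocks (y ∷ k)) + ∑ (λ D → atPred (P D) m) (blocks (y ∷ k)) + ∑ (λ D → atPred (Q D) m) (blocks (y ∷ k))
    ≡⟨ cong₂ (λ p q → ∑ X (blocks (y ∷ k)) + p + q) (∑-atPred P (blocks (y ∷ k)) m) (∑-atPred Q (blocks (y ∷ k)) m) ⟩
  gPairing m (y ∷ k) (w ∘→′) + atPred (λ n → ∑ (λ D → P D n) (blocks (y ∷ k))) m + atPred (λ n → ∑ (λ D → Q D n) (blocks (y ∷ k))) m
    ≡⟨ cong₂ (λ p q → gPairing m (y ∷ k) (w ∘→′) + p + q)
             (atPred-cong m (λ n → sym (gPairing-snoc-blocks y k 2 n (oneMinusT ⋆ w))))
             (atPred-cong m (λ n → sym (gPairing-upI-blocks y k n (minusTOneMinusT ⋆ (w ∘↑))))) ⟩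
  gPairing m (y ∷ k) (w ∘→′) + atPred (λ n → gPairing n ((y ∷ k) ++ 2 ∷ []) (oneMinusT ⋆ w)) m
    + atPred (λ n → gPairing n (upI (y ∷ k)) (minusTOneMinusT ⋆ (w ∘↑))) m ∎
  where
  open ≡-Reasoning
  N : List Index → ℕ
  N D = length (y ∷ k) ∸ length D
  μ : List Index → Poly
  μ D = [-t[1-t]]^ (N D)
  X : List Index → ℚ
  X D = blockPairing 1 D m (μ D ⋆ (w ∘→′))
  P Q : List Index → ℕ → ℚ
  P D n = blockPairing 1 (appendBlock 2 D) n (μ D ⋆ (oneMinusT ⋆ w)) + blockPairing 1 (extendLastBlock 2 D) n ([-t[1-t]]^ (suc (N D)) ⋆ (oneMinusT ⋆ w))
  Q D n = blockPairing 1 (upBlocks D) n (μ D ⋆ (minusTOneMinusT ⋆ (w ∘↑)))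

⟪G[1]⟫ : ∀ m w → ⟪ G m (1 ∷ []) ⟫ w ≡ ⟪ ⟦ suc m ∷ [] ⟧ ⟫ w
⟪G[1]⟫ m w = begin
  ⟪ G m (1 ∷ []) ⟫ w
    ≡⟨ ⟪G⟫ m (1 ∷ []) w ⟩
  blockPairing 1 ((1 ∷ []) ∷ []) m W′ + 0ℚ
    ≡⟨ ℚP.+-identityʳ _ ⟩
  blockPairing 1 ((1 ∷ []) ∷ []) m W′
    ≡⟨ blockPairing-[b] 1 (1 ∷ []) m W′ ⟩
  (f 0 (ℤ.+ 2) m ▷ W′ (suc m ∷ [])) 0
    ≡⟨ trans (f[0,2,e]≐1 m (W′ (suc m ∷ [])) 0) (trans (▷-one (W′ (suc m ∷ [])) 0) (▷-one (It* w (suc m ∷ [])) 0)) ⟩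
  w (suc m ∷ []) 0 + 0ℚ
    ≡⟨ ℚP.+-identityʳ _ ⟩
  w (suc m ∷ []) 0
    ≡⟨ ⟪⟦⟧⟫ (suc m ∷ []) w ⟨
  ⟪ ⟦ suc m ∷ [] ⟧ ⟫ w ∎
  where
  open ≡-Reasoning
  W′ = [-t[1-t]]^ 0 ⋆ It* w

⟪G-upIdx⟫ : ∀ y k m w → ⟪ G m (upIdx (y ∷ k)) ⟫ w ≡ ⟪ (G m (y ∷ k)) ↑ ⊕ t · (Gprev m (upIdx (y ∷ k))) ↑ ⟫ w
⟪G-upIdx⟫ y k m w = begin
  ⟪ G m (upI K) ⟫ w
    ≡⟨ ⟪G⟫ m (upI K) w ⟩
  gPairing m (upI K) (It* w)
    ≡⟨ gPairing-upI y k m (It* w) ⟩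
  gPairing m K (It* w ∘↑) + atPred (λ n → gPairing n (upI K) (t ⋆ (It* w ∘↑))) m
    ≡⟨ cong₂ _+_ (gPairing-cong-∷ m K tt {It* w ∘↑} {It* (w ∘↑)} (It*-upI w))
                 (atPred-cong m (λ n → gPairing-cong-∷ n (upI K) (upI-nonEmpty y k) {t ⋆ (It* w ∘↑)} {It* ((t ⋆ w) ∘↑)} tIt*↑≡It*t↑)) ⟩
  gPairing m K (It* (w ∘↑)) + atPred (λ n → gPairing n (upI K) (It* ((t ⋆ w) ∘↑))) m
    ≡⟨ cong₂ _+_ (⟪G⟫ m K (w ∘↑)) (⟪Gprev⟫ m (upI K) ((t ⋆ w) ∘↑)) ⟨
  ⟪ G m K ⟫ (w ∘↑) + ⟪ Gprev m (upI K) ⟫ ((t ⋆ w) ∘↑)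
    ≡⟨ cong₂ _+_ (⟪⟫-mapIdx upI (G m K) w) (trans (⟪·⟫ t (Gprev m (upI K) ↑) w) (⟪⟫-mapIdx upI (Gprev m (upI K)) (t ⋆ w))) ⟨
  ⟪ G m K ↑ ⟫ w + ⟪ t · Gprev m (upI K) ↑ ⟫ w
    ≡⟨ ⟪⟫-++ (G m K ↑) (t · Gprev m (upI K) ↑) w ⟨
  ⟪ G m K ↑ ⊕ t · Gprev m (upI K) ↑ ⟫ w ∎
  where
  open ≡-Reasoning
  K = y ∷ k
  tIt*↑≡It*t↑ : ∀ a κ j → (t ▷ It* w (upI (a ∷ κ))) j ≡ It* ((t ⋆ w) ∘↑) (a ∷ κ) j
  tIt*↑≡It*t↑ a κ j = trans (▷-t (It* w (upI (a ∷ κ))) j) (trans (It*-upI w a κ (suc j)) (sym (It*-⋆t (w ∘↑) (a ∷ κ) j)))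

module _ (y : ℕ) (k : Index) (m : ℕ) (w : Weight) where

  private
    K = y ∷ k
    Γ↑ Γ→ Γt Q D′ : ℚ
    Γ↑ = gPairing m K (It* (w ∘↑))
    Γ→ = gPairing m K (It* (w ∘→′))
    Γt = gPairing m K (It* (t ⋆ (w ∘↑)))
    Q  = atPred (λ n → gPairing n (upI K) (t ⋆ (It* (oneMinusT ⋆ w) ∘↑))) m
    D′ = atPred (λ n → gPairing n (K ++ 2 ∷ []) (It* (oneMinusT ⋆ w))) m

  ⟪G[k→]⟫ : ⟪ G m (K ++ 1 ∷ []) ⟫ w ≡ ((Γ→ + Γt) + D′) + - Q
  ⟪G[k→]⟫ = begin
    ⟪ G m (K ++ 1 ∷ []) ⟫ w
      ≡⟨ ⟪G⟫ m (K ++ 1 ∷ []) w ⟩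
    gPairing m (K ++ 1 ∷ []) (It* w)
      ≡⟨ gPairing-snoc-1 y k m (It* w) ⟩
    gPairing m K (It* w ∘→′) + atPred (λ n → gPairing n (K ++ 2 ∷ []) (oneMinusT ⋆ It* w)) m
      + atPred (λ n → gPairing n (upI K) (minusTOneMinusT ⋆ (It* w ∘↑))) m
      ≡⟨ cong₂ _+_ (cong₂ _+_ snoc-1 oneMinusT-inside) minus-Q ⟩
    ((Γ→ + Γt) + D′) + - Q ∎
    where
    open ≡-Reasoning
    snoc-1 : gPairing m K (It* w ∘→′) ≡ Γ→ + Γt
    snoc-1 = trans (gPairing-cong-∷ m K tt {It* w ∘→′} {It* (w ∘→′) ⊞ It* (t ⋆ (w ∘↑))} (It*-snoc-1 w))
                   (gPairing-⊞ m K (It* (w ∘→′)) (It* (t ⋆ (w ∘↑))))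
    oneMinusT-inside : atPred (λ n → gPairing n (K ++ 2 ∷ []) (oneMinusT ⋆ It* w)) m ≡ D′
    oneMinusT-inside = atPred-cong m (λ n → gPairing-cong n (K ++ 2 ∷ []) (λ κ j → sym (It*-⋆oneMinusT w κ j)))
    minus-Q : atPred (λ n → gPairing n (upI K) (minusTOneMinusT ⋆ (It* w ∘↑))) m ≡ - Q
    minus-Q = trans (atPred-cong m (λ n → trans
                      (gPairing-cong n (upI K) {w′ = ⊟ (t ⋆ (It* (oneMinusT ⋆ w) ∘↑))} (λ κ j →
                        trans (▷-minusTOneMinusT (It* w (upI κ)) j)
                              (cong -_ (trans (sym (It*-⋆oneMinusT w (upI κ) (suc j)))
                                              (sym (▷-t (It* (oneMinusT ⋆ w) (upI κ)) j))))))
                      (gPairing-⊟ n (upI K) (t ⋆ (It* (oneMinusT ⋆ w) ∘↑)))))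
                    (atPred-neg (λ n → gPairing n (upI K) (t ⋆ (It* (oneMinusT ⋆ w) ∘↑))) m)

  ⟪G[k↑]⟫-⋆oneMinusT : ⟪ G m (upI K) ⟫ (oneMinusT ⋆ w) ≡ (Γ↑ + - Γt) + Q
  ⟪G[k↑]⟫-⋆oneMinusT = begin
    ⟪ G m (upI K) ⟫ (oneMinusT ⋆ w)
      ≡⟨ ⟪G⟫ m (upI K) (oneMinusT ⋆ w) ⟩
    gPairing m (upI K) (It* (oneMinusT ⋆ w))
      ≡⟨ gPairing-upI y k m (It* (oneMinusT ⋆ w)) ⟩
    gPairing m K (It* (oneMinusT ⋆ w) ∘↑) + Q
      ≡⟨ cong (_+ Q) (gPairing-cong-∷ m K tt {It* (oneMinusT ⋆ w) ∘↑} {It* (w ∘↑) ⊞ ⊟ It* (t ⋆ (w ∘↑))} split) ⟩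
    gPairing m K (It* (w ∘↑) ⊞ ⊟ It* (t ⋆ (w ∘↑))) + Q
      ≡⟨ cong (_+ Q) (trans (gPairing-⊞ m K (It* (w ∘↑)) (⊟ It* (t ⋆ (w ∘↑))))
                            (cong (Γ↑ +_) (gPairing-⊟ m K (It* (t ⋆ (w ∘↑)))))) ⟩
    (Γ↑ + - Γt) + Q ∎
    where
    open ≡-Reasoning
    split : ∀ a κ j → It* (oneMinusT ⋆ w) (upI (a ∷ κ)) j ≡ It* (w ∘↑) (a ∷ κ) j - It* (t ⋆ (w ∘↑)) (a ∷ κ) j
    split a κ j = begin
      It* (oneMinusT ⋆ w) (upI (a ∷ κ)) j   ≡⟨ It*-upI (oneMinusT ⋆ w) a κ j ⟩
      It* (oneMinusT ⋆ (w ∘↑)) (a ∷ κ) j    ≡⟨ It*-⋆oneMinusT (w ∘↑) (a ∷ κ) j ⟩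
      (oneMinusT ▷ It* (w ∘↑) (a ∷ κ)) j    ≡⟨ ▷-oneMinusT (It* (w ∘↑) (a ∷ κ)) j ⟩
      It* (w ∘↑) (a ∷ κ) j - It* (w ∘↑) (a ∷ κ) (suc j)
        ≡⟨ cong (λ z → It* (w ∘↑) (a ∷ κ) j - z) (It*-⋆t (w ∘↑) (a ∷ κ) j) ⟨
      It* (w ∘↑) (a ∷ κ) j - It* (t ⋆ (w ∘↑)) (a ∷ κ) j ∎

  ⟪G-rightIdx⟫ : ⟪ G m (rightIdx K) ⟫ w
    ≡ ⟪ (G m K) ↑ ⊕ (G m K) →′ ⊖ oneMinusT · G m (upIdx K) ⊕ oneMinusT · Gprev m (rightUpIdx K) ⟫ w
  ⟪G-rightIdx⟫ = begin
    ⟪ G m (rightIdx K) ⟫ w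
      ≡⟨ ⟪G[k→]⟫ ⟩
    ((Γ→ + Γt) + D′) + - Q
      ≡⟨ solve 5 (λ a r t q d → ((r :+ t) :+ d) :+ (:- q) := ((a :+ r) :+ (:- ((a :+ (:- t)) :+ q))) :+ d) refl Γ↑ Γ→ Γt Q D′ ⟩
    ((Γ↑ + Γ→) + - ((Γ↑ + - Γt) + Q)) + D′
      ≡⟨ cong₂ _+_ (cong₂ _+_ (trans (⟪⟫-++ ((G m K) ↑) ((G m K) →′) w) (cong₂ _+_ up right))
                              (trans (⟪⟫-neg (oneMinusT · G m (upI K)) w)
                                     (cong -_ (trans (⟪·⟫ oneMinusT (G m (upI K)) w) ⟪G[k↑]⟫-⋆oneMinusT))))
                   (trans (⟪·⟫ oneMinusT (Gprev m (K ++ 2 ∷ [])) w) (⟪Gprev⟫ m (K ++ 2 ∷ []) (oneMinusT ⋆ w))) ⟨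
    (⟪ (G m K) ↑ ⊕ (G m K) →′ ⟫ w + ⟪ neg (oneMinusT · G m (upI K)) ⟫ w) + ⟪ oneMinusT · Gprev m (K ++ 2 ∷ []) ⟫ w
      ≡⟨ cong (_+ ⟪ oneMinusT · Gprev m (K ++ 2 ∷ []) ⟫ w) (⟪⟫-++ ((G m K) ↑ ⊕ (G m K) →′) (neg (oneMinusT · G m (upI K))) w) ⟨
    ⟪ (G m K) ↑ ⊕ (G m K) →′ ⊖ oneMinusT · G m (upI K) ⟫ w + ⟪ oneMinusT · Gprev m (K ++ 2 ∷ []) ⟫ w
      ≡⟨ ⟪⟫-++ ((G m K) ↑ ⊕ (G m K) →′ ⊖ oneMinusT · G m (upI K)) (oneMinusT · Gprev m (K ++ 2 ∷ [])) w ⟨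
    ⟪ (G m K) ↑ ⊕ (G m K) →′ ⊖ oneMinusT · G m (upI K) ⊕ oneMinusT · Gprev m (K ++ 2 ∷ []) ⟫ w ∎
    where
    open ≡-Reasoning
    up : ⟪ (G m K) ↑ ⟫ w ≡ Γ↑
    up = trans (⟪⟫-mapIdx upI (G m K) w) (⟪G⟫ m K (w ∘↑))
    right : ⟪ (G m K) →′ ⟫ w ≡ Γ→
    right = trans (⟪⟫-mapIdx (λ κ → κ ++ 1 ∷ []) (G m K) w) (⟪G⟫ m K (w ∘→′))

G-[1] : ∀ m → G m (1 ∷ []) ≈ ⟦ suc m ∷ [] ⟧
G-[1] m = ≈-fromPairing (G m (1 ∷ [])) ⟦ suc m ∷ [] ⟧ (⟪G[1]⟫ m)

G-upIdx : ∀ y k m → G m (upIdx (y ∷ k)) ≈ (G m (y ∷ k)) ↑ ⊕ t · (Gprev m (upIdx (y ∷ k))) ↑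
G-upIdx y k m =
  ≈-fromPairing (G m (upIdx (y ∷ k))) ((G m (y ∷ k)) ↑ ⊕ t · (Gprev m (upIdx (y ∷ k))) ↑) (⟪G-upIdx⟫ y k m)

G-rightIdx : ∀ y k m →
  G m (rightIdx (y ∷ k)) ≈ (G m (y ∷ k)) ↑ ⊕ (G m (y ∷ k)) →′ ⊖ oneMinusT · G m (upIdx (y ∷ k)) ⊕ oneMinusT · Gprev m (rightUpIdx (y ∷ k))
G-rightIdx y k m =
  ≈-fromPairing (G m (rightIdx (y ∷ k)))
    ((G m (y ∷ k)) ↑ ⊕ (G m (y ∷ k)) →′ ⊖ oneMinusT · G m (upIdx (y ∷ k)) ⊕ oneMinusT · Gprev m (rightUpIdx (y ∷ k)))
    (⟪G-rightIdx⟫ y k m)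

proposition2p5 : ((m : ℕ) → G m (1 ∷ []) ≈ ⟦ suc m ∷ [] ⟧)
    × ((k : List ℕ) → k ≢ [] → All (1 ≤_) k → (m : ℕ) →
        (G m (upIdx k) ≈ (G m k) ↑ ⊕ t · (Gprev m (upIdx k)) ↑)
        × (G m (rightIdx k) ≈ (G m k) ↑ ⊕ (G m k) →′ ⊖ oneMinusT · G m (upIdx k) ⊕ oneMinusT · Gprev m (rightUpIdx k)))
proposition2p5 = G-[1] , λ
  { []      []≢[] _ _ → ⊥-elim ([]≢[] refl)
  -- positivity of the entries of k is never needed
  ; (y ∷ k) _     _ m → G-upIdx y k m , G-rightIdx y k m
  }
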